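{- Let $\alpha=(\alpha_1,\dots,\alpha_n)$ be nonnegative integers, $m=\sum_i\alpha_i$, and let $X=(x_1,\dots,x_n)$ and $Y=(y_1,\dots,y_k)$ be tuples of formal variables. Then there exists a sijection $$D(H(Y,X,\alpha))\;\longleftrightarrow\;\prod_{1\le i<j\le n}\{x_j,-x_i\}^{\alpha_i\alpha_j}.$$
   Context: A (weighted) signed set is a finite set $S$ with a weight function $w_S$ assigning to each element a signed product of formal variables ($\pm$ a monomial); $w(S)=\sum_{s\in S}w(s)$. For signed sets $A,B$: $A+B$ is the disjoint union with inherited weights; $-A$ is a copy of $A$ with negated weights; $A-B=A+(-B)$; $A\times B$ is the Cartesian product with $w((a,b))=w(a)w(b)$, and $A^k$ the $k$-fold product (with $A^0$ a single element of weight $1$). $\{x_j,-x_i\}$ denotes a two-element signed set with weights $x_j$ and $-x_i$. A sijection between signed sets $S$ and $T$ is an involution $f$ on $S\sqcup T$ such that $w(f(x))=-w(x)$ if $x$ and $f(x)$ lie in the same one of $S,T$, and $w(f(x))=w(x)$ otherwise. For formal variables $z_1,\dots,z_r$ and an integer $k$, $B((z_1,\dots,z_r),k)$ is the signed set of tuples $(a_1,\dots,a_r)$ of nonnegative integers with $\sum a_i=k$ (empty if $k<0$), with weight $\prod z_i^{a_i}$. For $\alpha,m\ge0$, $M(Y,x,\alpha,m)$ is the $\alpha\times m$ matrix of signed sets with $(i,j)$ entry $B((y_1,\dots,y_k,x,\dots,x),j-i)$, where $x$ is repeated $i$ times. $H(Y,X,\alpha)$ is the $m\times m$ block matrix obtained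 by stacking $M(Y,x_1,\alpha_1,m),\dots,M(Y,x_n,\alpha_n,m)$ vertically. For an $N\times N$ matrix $M$ of signed sets, $D(M)$ is the signed set $\{(\sigma,(m_1,\dots,m_N)):\sigma\in S_N,\ m_i\in M_{i,\sigma(i)}\}$ with weight $\mathrm{sgn}(\sigma)\prod_i w(m_i)$. -}

module Defs where

open import Level using (0ℓ)
open import Data.Bool using (Bool; true; false; not; _xor_; if_then_else_; T; _∧_; _∨_)
open import Data.Nat as ℕ using (ℕ; zero; suc; _+_; _*_)
open import Data.Integer as ℤ using (ℤ; +_; _-_)
open import Data.Fin as F using (Fin; toℕ; splitAt)
open import Data.Vec as V using (Vec; []; _∷_; lookup; tabulate; zipWith; replicate; _++_; sum)
open import Data.List as L using (List; allFin; concatMap; filter)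
open import Data.Product using (Σ; _×_; _,_; proj₁; proj₂)
open import Data.Sum using (_⊎_; inj₁; inj₂)
open import Data.Unit using (⊤; tt)
open import Data.Bool.ListAction using () renaming (any to anyB; all to allB)
open import Relation.Nullary using (¬_; does)
open import Relation.Binary.PropositionalEquality using (_≡_)

-- Weights: ± monomials in V formal variables (indexed by Fin V).
-- A weight is (sign , exponent vector); sign true means negative.

Weight : ℕ → Set
Weight V = Bool × Vec ℕ V

wone : ∀ {V} → Weight V
wone = false , replicate _ 0

_w*_ : ∀ {V} → Weight V → Weight V → Weight V
(s , a) w* (t , b) = (s xor t) , zipWith _+_ a b

wneg : ∀ {V} → Weight V → Weight V
wneg (s , a) = not s , a

var : ∀ {V} → Fin V → Weight V
var {V} v = false , tabulate (λ u → if does (u F.≟ v) then 1 else 0)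

wpow : ∀ {V} → Weight V → ℕ → Weight V
wpow z zero = wone
wpow z (suc e) = z w* wpow z e

-- Signed sets (the carriers arising here are all finite).

record SignedSet (V : ℕ) : Set₁ where
  field
    Carrier : Set
    w       : Carrier → Weight V
open SignedSet public

pair : ∀ {V} → Weight V → Weight V → SignedSet V
pair a b = record { Carrier = Bool ; w = λ { true → a ; false → b } }

_⊗_ : ∀ {V} → SignedSet V → SignedSet V → SignedSet V
A ⊗ B = record { Carrier = Carrier A × Carrier B
               ; w = λ { (a , b) → w A a w* w B b } }

unitS : ∀ {V} → SignedSet V
unitS = record { Carrier = ⊤ ; w = λ _ → wone }

_^S_ : ∀ {V} → SignedSet V → ℕ → SignedSet V
A ^S zero = unitS
A ^S suc k = A ⊗ (A ^S k)

prodS : ∀ {V} → List (SignedSet V) → SignedSet V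
prodS L.[] = unitS
prodS (A L.∷ As) = A ⊗ prodS As

module _ {V : ℕ} (S T : SignedSet V) where

  wU : Carrier S ⊎ Carrier T → Weight V
  wU (inj₁ s) = w S s
  wU (inj₂ t) = w T t

  sameSide : Carrier S ⊎ Carrier T → Carrier S ⊎ Carrier T → Bool
  sameSide (inj₁ _) (inj₁ _) = true
  sameSide (inj₂ _) (inj₂ _) = true
  sameSide _ _ = false

  record Sijection : Set where
    field
      f          : Carrier S ⊎ Carrier T → Carrier S ⊎ Carrier T
      involutive : ∀ x → f (f x) ≡ x
      weight-same  : ∀ x → sameSide x (f x) ≡ true  → wU (f x) ≡ wneg (wU x)
      weight-cross : ∀ x → sameSide x (f x) ≡ false → wU (f x) ≡ wU x

monoW : ∀ {V r} → Vec (Fin V) r → Vec ℕ r → Weight V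
monoW [] [] = wone
monoW (z ∷ zs) (a ∷ as) = wpow (var z) a w* monoW zs as

B : ∀ {V r} → Vec (Fin V) r → ℤ → SignedSet V
B {r = r} zs d = record
  { Carrier = Σ (Vec ℕ r) (λ a → + sum a ≡ d)
  ; w = λ p → monoW zs (proj₁ p) }

-- Variables: y_1..y_k are Fin (k + n) indices inject+ n i,
-- x_1..x_n are raise k j.

yv : ∀ {k} n → Fin k → Fin (k + n)
yv n i = i F.↑ˡ n

xv : ∀ k {n} → Fin n → Fin (k + n)
xv k j = k F.↑ʳ j

ys : ∀ k n → Vec (Fin (k + n)) k
ys k n = tabulate (yv n)

-- M(Y, x, α, m) with 0-based indices i : Fin α, j : Fin m;
-- entry B((y_1..y_k, x repeated i+1 times), j - i).
Mmat : ∀ k n → Fin n → (a m : ℕ) → Fin a → Fin m → SignedSet (k + n)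
Mmat k n l a m i j =
  B (ys k n ++ replicate (suc (toℕ i)) (xv k l)) (+ toℕ j - + toℕ i)

-- splitting a row index of the stacked matrix into (block, row in block)
rowInfo : ∀ {n} (α : Vec ℕ n) → Fin (sum α) → Σ (Fin n) (λ l → Fin (lookup α l))
rowInfo (a ∷ α) r with splitAt a r
... | inj₁ i = F.zero , i
... | inj₂ r' with rowInfo α r'
...   | l , i = F.suc l , i

H : ∀ k n (α : Vec ℕ n) → Fin (sum α) → Fin (sum α) → SignedSet (k + n)
H k n α r c with rowInfo α r
... | l , i = Mmat k n l (lookup α l) (sum α) i c

-- Permutations of Fin N, as vectors (σ(0),…,σ(N-1)) that hit every value.

isPerm : ∀ {N} → Vec (Fin N) N → Bool
isPerm {N} v = allB (λ j → anyB (λ i → does (lookup v i F.≟ j)) (allFin N)) (allFin N)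

Perm : ℕ → Set
Perm N = Σ (Vec (Fin N) N) (λ v → T (isPerm v))

-- sign: true iff the number of inversions is odd
sgnNeg : ∀ {N} → Vec (Fin N) N → Bool
sgnNeg {N} v = L.foldr _xor_ false
  (L.map (λ i → L.foldr _xor_ false
     (L.map (λ j → does (toℕ i ℕ.<? toℕ j) ∧ does (toℕ (lookup v j) ℕ.<? toℕ (lookup v i)))
            (allFin N)))
   (allFin N))

Tuple : ∀ {V} (N : ℕ) → (Fin N → SignedSet V) → Set
Tuple zero A = ⊤
Tuple (suc N) A = Carrier (A F.zero) × Tuple N (λ i → A (F.suc i))

tupleW : ∀ {V} (N : ℕ) (A : Fin N → SignedSet V) → Tuple N A → Weight V
tupleW zero A _ = wone
tupleW (suc N) A (m , ms) = w (A F.zero) m w* tupleW N (λ i → A (F.suc i)) ms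

D : ∀ {V N} → (Fin N → Fin N → SignedSet V) → SignedSet V
D {V} {N} M = record
  { Carrier = Σ (Perm N) (λ σ → Tuple N (λ i → M i (lookup (proj₁ σ) i)))
  ; w = λ { (σ , ms) → (sgnNeg (proj₁ σ) , replicate _ 0)
                        w* tupleW N (λ i → M i (lookup (proj₁ σ) i)) ms } }

pairsLT : ∀ n → List (Fin n × Fin n)
pairsLT n = concatMap (λ i → L.map (i ,_) (filter (λ j → toℕ i ℕ.<? toℕ j) (allFin n))) (allFin n)

RHS : ∀ k n (α : Vec ℕ n) → SignedSet (k + n)
RHS k n α = prodS (L.map (λ { (i , j) →
  pair (var (xv k j)) (wneg (var (xv k i))) ^S (lookup α i * lookup α j) }) (pairsLT n))

module Submission where

-- A sijection between two finite signed sets exists as soon as their generating functions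
-- agree: list S ⊔ T, count the elements of T with the opposite sign, and pair the r-th element
-- of weight m with the r-th element of weight -m. So the theorem reduces to the polynomial
-- identity det H(Y, X, α) = ∏_{i<j} (x_j - x_i)^{α_i α_j}, whose entries are the complete
-- homogeneous polynomials h_{c-i}(Y, x_l, …, x_l), the generating functions of the sets B.
-- The identity holds over every commutative ring. If α₁ > 0, work top to bottom through the
-- rows of the blocks of x₂, …, x_n and subtract the row above in the same block (for the first
-- row of a block: the first row of the matrix). Since h(W, z, U) - h(W, x₁, U) =
-- (z - x₁) h(W, x₁, z, U), this extracts a factor x_j - x₁ from every row of the block of x_j,
-- turns the first column into (1, 0, …, 0) and leaves the minor H(Y ∪ {x₁}, X, (α₁ - 1, α₂, …));
-- induction on α₁ and on n finishes.

open import Algebra.Bundles using (CommutativeMonoid; CommutativeRing)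
open import Algebra.Structures using (IsCommutativeRing)
import Algebra.Properties.CommutativeSemigroup as CommutativeSemigroupProperties
open import Data.Bool using (Bool; true; false; not; _xor_; _∧_; _∨_; if_then_else_; T)
import Data.Bool.Properties as BP
open import Data.Bool.ListAction using (and; or)
open import Data.Empty using (⊥; ⊥-elim)
open import Data.Fin as F using (Fin; zero; suc; toℕ; _↑ˡ_; _↑ʳ_; splitAt)
import Data.Fin.Properties as FP
open import Data.Integer as ℤ using (ℤ; +_; -[1+_])
import Data.Integer.Properties as ℤP
open import Data.List as L using (List; []; _∷_; _++_; concatMap; allFin)
import Data.List.Properties as LP
open import Data.List.Membership.Propositional using (_∈_)
import Data.List.Membership.Propositional.Properties as ∈P
open import Data.List.Relation.Unary.All using ([]; _∷_)
import Data.List.Relation.Unary.All as All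
open import Data.List.Relation.Unary.AllPairs using ([]; _∷_)
open import Data.List.Relation.Unary.Any using (here; there)
import Data.List.Relation.Unary.Any as Any
import Data.List.Relation.Unary.Any.Properties as AnyP
open import Data.List.Relation.Unary.Unique.Propositional using (Unique)
import Data.List.Relation.Unary.Unique.Propositional.Properties as UniqueP
open import Data.Maybe using (Maybe; just; nothing)
import Data.Maybe.Properties as MaybeP
open import Data.Nat as ℕ using (ℕ; zero; suc; _<_; z≤n; s≤s)
import Data.Nat.Properties as ℕP
open import Data.Product using (Σ; ∃; _×_; _,_; proj₁; proj₂)
open import Data.Sum using (_⊎_; inj₁; inj₂)
open import Data.Unit using (⊤; tt)
open import Data.Vec as V using (Vec; []; _∷_; lookup)
import Data.Vec.Properties as VP
open import Data.Vec.Functional using (updateAt; removeAt)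
import Data.Vec.Functional.Properties as VFP
open import Function using (_∘_; id)
open import Level using (0ℓ)
open import Relation.Binary.Definitions using (DecidableEquality; tri<; tri≈; tri>)
open import Relation.Binary.PropositionalEquality as ≡ using (_≡_; _≢_)
open import Relation.Nullary using (yes; no; does; Dec; ¬_)
open import Relation.Nullary.Decidable using (dec-true; dec-false)
open import Defs using (isPerm; sgnNeg; rowInfo; pairsLT)

module Permutations where

  open ≡ using (refl; sym; trans; cong; cong₂; module ≡-Reasoning)

  private
    variable
      A : Set
      L N : ℕ
    module Or = CommutativeSemigroupProperties (CommutativeMonoid.commutativeSemigroup BP.∨-commutativeMonoid)
    module Xor = CommutativeSemigroupProperties (CommutativeRing.+-commutativeSemigroup BP.xor-∧-commutativeRing)

  swapAt : ℕ → Vec A L → Vec A L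
  swapAt zero (a ∷ b ∷ w) = b ∷ a ∷ w
  swapAt (suc r) (a ∷ w) = a ∷ swapAt r w
  swapAt _ w = w

  occurs : Fin N → Vec (Fin N) L → Bool
  occurs j [] = false
  occurs j (a ∷ w) = does (a F.≟ j) ∨ occurs j w

  isPerm-occurs : (v : Vec (Fin N) N) → isPerm v ≡ and (L.tabulate (λ j → occurs j v))
  isPerm-occurs {N} v = begin
    isPerm v                                                          ≡⟨ cong and (LP.map-tabulate id occursAt) ⟩
    and (L.tabulate occursAt)
      ≡⟨ cong and (LP.tabulate-cong (λ j → trans (cong or (LP.map-tabulate id (λ i → does (lookup v i F.≟ j)))) (or-lookup j v))) ⟩
    and (L.tabulate (λ j → occurs j v))                                 ∎
    where
    open ≡-Reasoning
    occursAt : Fin N → Bool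
    occursAt j = or (L.map (λ i → does (lookup v i F.≟ j)) (allFin N))
    or-lookup : ∀ {L} j (w : Vec (Fin N) L) → or (L.tabulate (λ i → does (lookup w i F.≟ j))) ≡ occurs j w
    or-lookup j [] = refl
    or-lookup j (a ∷ w) = cong (does (a F.≟ j) ∨_) (or-lookup j w)

  and-tabulate⁻ : ∀ {n} (f : Fin n → Bool) → and (L.tabulate f) ≡ true → ∀ i → f i ≡ true
  and-tabulate⁻ f eq zero with f zero
  ... | true = refl
  and-tabulate⁻ f eq (suc i) with f zero
  ... | true = and-tabulate⁻ (f ∘ suc) eq i

  occurs⁻ : ∀ j (v : Vec (Fin N) L) → occurs j v ≡ true → ∃ λ i → lookup v i ≡ j
  occurs⁻ j (a ∷ v) eq with a F.≟ j
  ... | yes a≡j = zero , a≡j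
  ... | no _ with i , vi≡j ← occurs⁻ j v eq = suc i , vi≡j

  perm-surjective : (v : Vec (Fin N) N) → isPerm v ≡ true → ∀ j → ∃ λ i → lookup v i ≡ j
  perm-surjective v isP j = occurs⁻ j v (and-tabulate⁻ _ (trans (sym (isPerm-occurs v)) isP) j)

  surjective⇒injective : ∀ {n} (f : Fin n → Fin n) → (∀ j → ∃ λ i → f i ≡ j) →
                         ∀ {r s} → f r ≡ f s → r ≡ s
  surjective⇒injective {suc n} f surj {r} {s} fr≡fs with r F.≟ s
  ... | yes r≡s = r≡s
  ... | no r≢s = ⊥-elim (FP.<-irrefl (trans (sym (hit i)) (trans (cong f gi≡gj) (hit j))) i<j)
    where
    -- a right inverse of f whose values avoid s, so that it factors through Fin n
    section : ∀ j → Σ (Fin (suc n)) λ i → s ≢ i × f i ≡ j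
    section j with surj j
    ... | i , fi≡j with i F.≟ s
    ...   | yes refl = r , (λ s≡r → r≢s (sym s≡r)) , trans fr≡fs fi≡j
    ...   | no i≢s = i , (λ s≡i → i≢s (sym s≡i)) , fi≡j
    g : Fin (suc n) → Fin (suc n)
    g j = proj₁ (section j)
    hit : ∀ j → f (g j) ≡ j
    hit j = proj₂ (proj₂ (section j))
    pigeon = FP.pigeonhole (ℕP.n<1+n n) (λ j → F.punchOut (proj₁ (proj₂ (section j))))
    i = proj₁ pigeon
    j = proj₁ (proj₂ pigeon)
    i<j = proj₁ (proj₂ (proj₂ pigeon))
    gi≡gj = FP.punchOut-injective (proj₁ (proj₂ (section i))) (proj₁ (proj₂ (section j))) (proj₂ (proj₂ (proj₂ pigeon)))

  perm-injective : (v : Vec (Fin N) N) → isPerm v ≡ true → ∀ {r s} → lookup v r ≡ lookup v s → r ≡ s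
  perm-injective v isP = surjective⇒injective (lookup v) (perm-surjective v isP)

  occurs-swapAt : ∀ j r (v : Vec (Fin N) L) → occurs j (swapAt r v) ≡ occurs j v
  occurs-swapAt j zero (a ∷ b ∷ w) = Or.x∙yz≈y∙xz (does (b F.≟ j)) (does (a F.≟ j)) (occurs j w)
  occurs-swapAt j zero [] = refl
  occurs-swapAt j zero (a ∷ []) = refl
  occurs-swapAt j (suc r) [] = refl
  occurs-swapAt j (suc r) (a ∷ w) = cong (does (a F.≟ j) ∨_) (occurs-swapAt j r w)

  isPerm-swapAt : ∀ r (v : Vec (Fin N) N) → isPerm (swapAt r v) ≡ isPerm v
  isPerm-swapAt r v = trans (isPerm-occurs (swapAt r v))
    (trans (cong and (LP.tabulate-cong (λ j → occurs-swapAt j r v))) (sym (isPerm-occurs v)))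

  occurs-map-suc : ∀ j (u : Vec (Fin N) L) → occurs (suc j) (V.map suc u) ≡ occurs j u
  occurs-map-suc j [] = refl
  occurs-map-suc j (a ∷ u) = cong (does (a F.≟ j) ∨_) (occurs-map-suc j u)

  isPerm-zero∷suc : (u : Vec (Fin N) N) → isPerm (zero ∷ V.map suc u) ≡ isPerm u
  isPerm-zero∷suc u = trans (isPerm-occurs (zero ∷ V.map suc u))
    (trans (cong and (LP.tabulate-cong (λ j → occurs-map-suc j u))) (sym (isPerm-occurs u)))

  swapAt-fixed⇒repeat : ∀ r (v : Vec A L) → suc r < L → swapAt r v ≡ v →
                        ∃ λ i → ∃ λ j → i ≢ j × lookup v i ≡ lookup v j
  swapAt-fixed⇒repeat zero (a ∷ b ∷ w) _ eq = zero , suc zero , (λ ()) , sym (proj₁ (VP.∷-injective eq))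
  swapAt-fixed⇒repeat zero (a ∷ []) (s≤s ()) _
  swapAt-fixed⇒repeat (suc r) (a ∷ w) (s≤s r<L) eq
    with i , j , i≢j , vi≡vj ← swapAt-fixed⇒repeat r w r<L (proj₂ (VP.∷-injective eq)) =
    suc i , suc j , (λ si≡sj → i≢j (FP.suc-injective si≡sj)) , vi≡vj

  perm-swapAt≢ : ∀ r (v : Vec (Fin N) N) → isPerm v ≡ true → suc r < N → swapAt r v ≢ v
  perm-swapAt≢ r v isP r<N fixed with i , j , i≢j , vi≡vj ← swapAt-fixed⇒repeat r v r<N fixed =
    i≢j (perm-injective v isP vi≡vj)

  _<ᶠ_ : Fin N → Fin N → Bool
  a <ᶠ b = does (toℕ a ℕ.<? toℕ b)

  parityBelow : Fin N → Vec (Fin N) L → Bool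
  parityBelow a [] = false
  parityBelow a (b ∷ w) = (b <ᶠ a) xor parityBelow a w

  oddInversions : Vec (Fin N) L → Bool
  oddInversions [] = false
  oddInversions (a ∷ w) = parityBelow a w xor oddInversions w

  private
    parity : List Bool → Bool
    parity = L.foldr _xor_ false

    inversionTable : Vec (Fin N) L → Bool
    inversionTable v = parity (L.tabulate (λ i → parity (L.tabulate (λ j → (i <ᶠ j) ∧ (lookup v j <ᶠ lookup v i)))))

    parityBelow-lookup : ∀ a (w : Vec (Fin N) L) → parity (L.tabulate (λ j → lookup w j <ᶠ a)) ≡ parityBelow a w
    parityBelow-lookup a [] = refl
    parityBelow-lookup a (b ∷ w) = cong ((b <ᶠ a) xor_) (parityBelow-lookup a w)

    inversionTable≡oddInversions : (v : Vec (Fin N) L) → inversionTable v ≡ oddInversions v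
    inversionTable≡oddInversions [] = refl
    inversionTable≡oddInversions (a ∷ w) = cong₂ _xor_ (parityBelow-lookup a w) (inversionTable≡oddInversions w)

  sgnNeg≡oddInversions : (v : Vec (Fin N) N) → sgnNeg v ≡ oddInversions v
  sgnNeg≡oddInversions {N} v = trans
    (trans (cong parity (LP.map-tabulate id (λ i → parity (L.map (inverted i) (allFin N)))))
           (cong parity (LP.tabulate-cong (λ i → cong parity (LP.map-tabulate id (inverted i))))))
    (inversionTable≡oddInversions v)
    where
    inverted : Fin N → Fin N → Bool
    inverted i j = (i <ᶠ j) ∧ (lookup v j <ᶠ lookup v i)

  <ᶠ-flip : ∀ {a b : Fin N} → a ≢ b → a <ᶠ b ≡ not (b <ᶠ a)
  <ᶠ-flip {a = a} {b} a≢b with ℕP.<-cmp (toℕ a) (toℕ b)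
  ... | tri< a<b _ b≮a = trans (dec-true (_ ℕ.<? _) a<b) (cong not (sym (dec-false (_ ℕ.<? _) b≮a)))
  ... | tri≈ _ a≡b _ = ⊥-elim (a≢b (FP.toℕ-injective a≡b))
  ... | tri> a≮b _ b<a = trans (dec-false (_ ℕ.<? _) a≮b) (cong not (sym (dec-true (_ ℕ.<? _) b<a)))

  parityBelow-swapAt : ∀ a r (w : Vec (Fin N) L) → parityBelow a (swapAt r w) ≡ parityBelow a w
  parityBelow-swapAt a zero (b ∷ c ∷ w) = Xor.x∙yz≈y∙xz (c <ᶠ a) (b <ᶠ a) (parityBelow a w)
  parityBelow-swapAt a zero [] = refl
  parityBelow-swapAt a zero (b ∷ []) = refl
  parityBelow-swapAt a (suc r) [] = refl
  parityBelow-swapAt a (suc r) (b ∷ w) = cong ((b <ᶠ a) xor_) (parityBelow-swapAt a r w)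

  oddInversions-swapAt : ∀ r (v : Vec (Fin N) L) → swapAt r v ≢ v → oddInversions (swapAt r v) ≡ not (oddInversions v)
  oddInversions-swapAt zero (a ∷ b ∷ w) moved = begin
    ((a <ᶠ b) xor y) xor (z xor t)         ≡⟨ cong (λ u → (u xor y) xor (z xor t)) (<ᶠ-flip a≢b) ⟩
    (not x xor y) xor (z xor t)            ≡⟨ cong (_xor (z xor t)) (sym (BP.not-distribˡ-xor x y)) ⟩
    not (x xor y) xor (z xor t)            ≡⟨ sym (BP.not-distribˡ-xor (x xor y) (z xor t)) ⟩
    not ((x xor y) xor (z xor t))          ≡⟨ cong not (Xor.interchange x y z t) ⟩
    not ((x xor z) xor (y xor t))          ∎
    where
    open ≡-Reasoning
    a≢b : a ≢ b
    a≢b refl = moved refl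
    x = b <ᶠ a
    y = parityBelow b w
    z = parityBelow a w
    t = oddInversions w
  oddInversions-swapAt zero [] moved = ⊥-elim (moved refl)
  oddInversions-swapAt zero (a ∷ []) moved = ⊥-elim (moved refl)
  oddInversions-swapAt (suc r) [] moved = ⊥-elim (moved refl)
  oddInversions-swapAt (suc r) (a ∷ w) moved = begin
    parityBelow a (swapAt r w) xor oddInversions (swapAt r w)
      ≡⟨ cong₂ _xor_ (parityBelow-swapAt a r w) (oddInversions-swapAt r w (λ fixed → moved (cong (a ∷_) fixed))) ⟩
    parityBelow a w xor not (oddInversions w)  ≡⟨ sym (BP.not-distribʳ-xor (parityBelow a w) (oddInversions w)) ⟩
    not (parityBelow a w xor oddInversions w)  ∎
    where open ≡-Reasoning

  oddInversions-map-suc : (u : Vec (Fin N) L) → oddInversions (V.map suc u) ≡ oddInversions u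
  oddInversions-map-suc [] = refl
  oddInversions-map-suc (a ∷ u) = cong₂ _xor_ (parityBelow-map-suc u) (oddInversions-map-suc u)
    where
    parityBelow-map-suc : ∀ {L} (w : Vec (Fin _) L) → parityBelow (suc a) (V.map suc w) ≡ parityBelow a w
    parityBelow-map-suc [] = refl
    parityBelow-map-suc (b ∷ w) = cong ((b <ᶠ a) xor_) (parityBelow-map-suc w)

  oddInversions-zero∷suc : (u : Vec (Fin N) L) → oddInversions (zero ∷ V.map suc u) ≡ oddInversions u
  oddInversions-zero∷suc u = trans (cong (_xor oddInversions (V.map suc u)) (nothingBelowZero (V.map suc u)))
                                   (oddInversions-map-suc u)
    where
    nothingBelowZero : ∀ {L} (w : Vec (Fin (suc _)) L) → parityBelow zero w ≡ false
    nothingBelowZero [] = refl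
    nothingBelowZero (b ∷ w) = nothingBelowZero w

module Determinant {c ℓ} (R : CommutativeRing c ℓ) where

  open CommutativeRing R hiding (zero)
  open import Algebra.Properties.Ring ring using (-‿involutive; -0#≈0#; -1*x≈-x; -‿distribˡ-*)
  open import Algebra.Properties.CommutativeSemigroup *-commutativeSemigroup using (x∙yz≈y∙xz)
  open import Algebra.Properties.Semiring.Sum semiring
    using (sum; sum-syntax; ∑-comm; ∑-distrib-+; *-distribˡ-sum; sum-cong-≋; sum-replicate-zero)
  open import Algebra.Properties.CommutativeMonoid.Sum *-commutativeMonoid using ()
    renaming (sum to product; sum-cong-≋ to product-cong; sum-remove to product-remove;
              sum-replicate-zero to product-replicate-one)
  open import Relation.Binary.Reasoning.Setoid setoid
  open Permutations

  private variable
    L N : ℕ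

  Matrix : ℕ → ℕ → Set c
  Matrix m n = Fin m → Fin n → Carrier

  sum-neg : ∀ {n} (f : Fin n → Carrier) → ∑[ a < n ] (- f a) ≈ - ∑[ a < n ] f a
  sum-neg {n} f = begin
    ∑[ a < n ] (- f a)       ≈⟨ sum-cong-≋ (λ a → sym (-1*x≈-x (f a))) ⟩
    ∑[ a < n ] (- 1# * f a)  ≈⟨ *-distribˡ-sum (- 1#) f ⟨
    - 1# * ∑[ a < n ] f a    ≈⟨ -1*x≈-x _ ⟩
    - ∑[ a < n ] f a         ∎

  ∑∑-antisymmetric : ∀ {n} (G : Fin n → Fin n → Carrier) →
                     (∀ a b → G b a ≈ - G a b) → (∀ a → G a a ≈ 0#) → ∑[ a < n ] ∑[ b < n ] G a b ≈ 0#
  ∑∑-antisymmetric {zero} G anti diag = refl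
  ∑∑-antisymmetric {suc n} G anti diag = begin
    (G zero zero + firstRow) + ∑[ a < n ] (G (suc a) zero + ∑[ b < n ] G (suc a) (suc b))
      ≈⟨ +-cong (+-congʳ (diag zero)) (∑-distrib-+ (λ a → G (suc a) zero) _) ⟩
    (0# + firstRow) + (∑[ a < n ] G (suc a) zero + ∑[ a < n ] ∑[ b < n ] G (suc a) (suc b))
      ≈⟨ +-cong (+-identityˡ firstRow)
                (+-cong (trans (sum-cong-≋ (λ a → anti zero (suc a))) (sum-neg (G zero ∘ suc)))
                        (∑∑-antisymmetric (λ a b → G (suc a) (suc b)) (λ a b → anti (suc a) (suc b)) (diag ∘ suc))) ⟩
    firstRow + (- firstRow + 0#)  ≈⟨ +-congˡ (+-identityʳ (- firstRow)) ⟩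
    firstRow - firstRow           ≈⟨ -‿inverseʳ firstRow ⟩
    0#                            ∎
    where firstRow = ∑[ b < n ] G zero (suc b)

  ∑ᵛ : ∀ L → (Vec (Fin N) L → Carrier) → Carrier
  ∑ᵛ zero F = F []
  ∑ᵛ {N} (suc L) F = ∑[ a < N ] ∑ᵛ L (λ v → F (a ∷ v))

  ∑ᵛ-cong : ∀ L {F G : Vec (Fin N) L → Carrier} → (∀ v → F v ≈ G v) → ∑ᵛ L F ≈ ∑ᵛ L G
  ∑ᵛ-cong zero F≈G = F≈G []
  ∑ᵛ-cong {N} (suc L) F≈G = sum-cong-≋ {N} (λ a → ∑ᵛ-cong L (λ v → F≈G (a ∷ v)))

  ∑ᵛ-zero : ∀ L {F : Vec (Fin N) L → Carrier} → (∀ v → F v ≈ 0#) → ∑ᵛ L F ≈ 0#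
  ∑ᵛ-zero zero F≈0 = F≈0 []
  ∑ᵛ-zero {N} (suc L) F≈0 = trans (sum-cong-≋ {N} (λ a → ∑ᵛ-zero L (λ v → F≈0 (a ∷ v)))) (sum-replicate-zero N)

  *-distribˡ-∑ᵛ : ∀ L x (F : Vec (Fin N) L → Carrier) → x * ∑ᵛ L F ≈ ∑ᵛ L (λ v → x * F v)
  *-distribˡ-∑ᵛ zero x F = refl
  *-distribˡ-∑ᵛ {N} (suc L) x F =
    trans (*-distribˡ-sum x (λ a → ∑ᵛ L (λ v → F (a ∷ v))))
          (sum-cong-≋ {N} (λ a → *-distribˡ-∑ᵛ L x (λ v → F (a ∷ v))))

  ∑ᵛ-distrib-+ : ∀ L (F G : Vec (Fin N) L → Carrier) → ∑ᵛ L (λ v → F v + G v) ≈ ∑ᵛ L F + ∑ᵛ L G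
  ∑ᵛ-distrib-+ zero F G = refl
  ∑ᵛ-distrib-+ {N} (suc L) F G =
    trans (sum-cong-≋ {N} (λ a → ∑ᵛ-distrib-+ L (λ v → F (a ∷ v)) (λ v → G (a ∷ v))))
          (∑-distrib-+ (λ a → ∑ᵛ L (λ v → F (a ∷ v))) (λ a → ∑ᵛ L (λ v → G (a ∷ v))))

  -‿distrib-∑ᵛ : ∀ L (F : Vec (Fin N) L → Carrier) → - ∑ᵛ L F ≈ ∑ᵛ L (λ v → - F v)
  -‿distrib-∑ᵛ L F = begin
    - ∑ᵛ L F                    ≈⟨ -1*x≈-x _ ⟨
    - 1# * ∑ᵛ L F               ≈⟨ *-distribˡ-∑ᵛ L (- 1#) F ⟩
    ∑ᵛ L (λ v → - 1# * F v)     ≈⟨ ∑ᵛ-cong L (λ v → -1*x≈-x (F v)) ⟩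
    ∑ᵛ L (λ v → - F v)          ∎

  ∑ᵛ-swapAt : ∀ r L (F : Vec (Fin N) L → Carrier) → ∑ᵛ L F ≈ ∑ᵛ L (F ∘ swapAt r)
  ∑ᵛ-swapAt zero (suc (suc L)) F = sym (∑-comm (λ a b → ∑ᵛ L (λ w → F (b ∷ a ∷ w))))
  ∑ᵛ-swapAt zero zero F = refl
  ∑ᵛ-swapAt zero (suc zero) F = refl
  ∑ᵛ-swapAt (suc r) zero F = refl
  ∑ᵛ-swapAt {N} (suc r) (suc L) F = sum-cong-≋ {N} (λ a → ∑ᵛ-swapAt r L (λ w → F (a ∷ w)))

  ∑ᵛ-antisymmetric : ∀ r L (F : Vec (Fin N) L → Carrier) →
                     (∀ v → F (swapAt r v) ≈ - F v) → (∀ v → swapAt r v ≡ v → F v ≈ 0#) → ∑ᵛ L F ≈ 0#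
  ∑ᵛ-antisymmetric zero (suc (suc L)) F anti fixed = ∑∑-antisymmetric G antiG diagG
    where
    G : Fin _ → Fin _ → Carrier
    G a b = ∑ᵛ L (λ w → F (a ∷ b ∷ w))
    antiG : ∀ a b → G b a ≈ - G a b
    antiG a b = trans (∑ᵛ-cong L (λ w → anti (a ∷ b ∷ w))) (sym (-‿distrib-∑ᵛ L _))
    diagG : ∀ a → G a a ≈ 0#
    diagG a = ∑ᵛ-zero L (λ w → fixed (a ∷ a ∷ w) ≡.refl)
  ∑ᵛ-antisymmetric zero zero F anti fixed = fixed [] ≡.refl
  ∑ᵛ-antisymmetric zero (suc zero) F anti fixed = ∑ᵛ-zero 1 {F} λ { (a ∷ []) → fixed (a ∷ []) ≡.refl }
  ∑ᵛ-antisymmetric (suc r) zero F anti fixed = fixed [] ≡.refl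
  ∑ᵛ-antisymmetric {N} (suc r) (suc L) F anti fixed = trans
    (sum-cong-≋ {N} (λ a → ∑ᵛ-antisymmetric r L (λ w → F (a ∷ w)) (λ w → anti (a ∷ w))
                                          (λ w fixes → fixed (a ∷ w) (≡.cong (a ∷_) fixes))))
    (sum-replicate-zero N)

  signOf : (isPermutation odd : Bool) → Carrier
  signOf isPermutation odd = if isPermutation then (if odd then - 1# else 1#) else 0#

  sign : Vec (Fin N) N → Carrier
  sign v = signOf (isPerm v) (sgnNeg v)

  signOf-flip : ∀ p {odd odd′} → (p ≡ true → odd′ ≡ not odd) → signOf p odd′ ≈ - signOf p odd
  signOf-flip false flipped = sym -0#≈0#
  signOf-flip true {true} flipped rewrite flipped ≡.refl = sym (-‿involutive 1#)
  signOf-flip true {false} flipped rewrite flipped ≡.refl = refl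

  sign-swapAt : ∀ r (v : Vec (Fin N) N) → suc r < N → sign (swapAt r v) ≈ - sign v
  sign-swapAt r v r+1<N =
    trans (reflexive (≡.cong (λ p → signOf p (sgnNeg (swapAt r v))) (isPerm-swapAt r v))) (signOf-flip (isPerm v) flips)
    where
    flips : isPerm v ≡ true → sgnNeg (swapAt r v) ≡ not (sgnNeg v)
    flips isP = ≡.trans (sgnNeg≡oddInversions (swapAt r v))
      (≡.trans (oddInversions-swapAt r v (perm-swapAt≢ r v isP r+1<N)) (≡.cong not (≡.sym (sgnNeg≡oddInversions v))))

  sign-nonPerm : (v : Vec (Fin N) N) → isPerm v ≡ false → sign v ≈ 0#
  sign-nonPerm v notPerm = reflexive (≡.cong (λ p → signOf p (sgnNeg v)) notPerm)

  sign-swapAt-fixed : ∀ r (v : Vec (Fin N) N) → suc r < N → swapAt r v ≡ v → sign v ≈ 0#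
  sign-swapAt-fixed r v r+1<N fixed with isPerm v in isP
  ... | false = refl
  ... | true = ⊥-elim (perm-swapAt≢ r v isP r+1<N fixed)

  sign-zero∷suc : (u : Vec (Fin N) N) → sign (zero ∷ V.map suc u) ≡ sign u
  sign-zero∷suc u = ≡.cong₂ signOf (isPerm-zero∷suc u)
    (≡.trans (sgnNeg≡oddInversions (zero ∷ V.map suc u)) (≡.trans (oddInversions-zero∷suc u) (≡.sym (sgnNeg≡oddInversions u))))

  rowProduct : Matrix L N → Vec (Fin N) L → Carrier
  rowProduct M [] = 1#
  rowProduct M (a ∷ v) = M zero a * rowProduct (M ∘ suc) v

  rowProduct-cong : {M M′ : Matrix L N} → (∀ i j → M i j ≈ M′ i j) → ∀ v → rowProduct M v ≈ rowProduct M′ v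
  rowProduct-cong M≈M′ [] = refl
  rowProduct-cong M≈M′ (a ∷ v) = *-cong (M≈M′ zero a) (rowProduct-cong (M≈M′ ∘ suc) v)

  rowProduct-zero : (M : Matrix L N) (v : Vec (Fin N) L) (i : Fin L) → M i (lookup v i) ≈ 0# → rowProduct M v ≈ 0#
  rowProduct-zero M (a ∷ v) zero Mia≈0 = trans (*-congʳ Mia≈0) (zeroˡ _)
  rowProduct-zero M (a ∷ v) (suc i) Mia≈0 = trans (*-congˡ (rowProduct-zero (M ∘ suc) v i Mia≈0)) (zeroʳ _)

  rowProduct-map-suc : (M : Matrix L (suc N)) (u : Vec (Fin N) L) →
                       rowProduct M (V.map suc u) ≡ rowProduct (λ i j → M i (suc j)) u
  rowProduct-map-suc M [] = ≡.refl
  rowProduct-map-suc M (a ∷ u) = ≡.cong (M zero (suc a) *_) (rowProduct-map-suc (M ∘ suc) u)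

  det : Matrix N N → Carrier
  det {N} M = ∑ᵛ N (λ v → sign v * rowProduct M v)

  det-cong : {M M′ : Matrix N N} → (∀ i j → M i j ≈ M′ i j) → det M ≈ det M′
  det-cong {N} M≈M′ = ∑ᵛ-cong N (λ v → *-congˡ (rowProduct-cong M≈M′ v))

  _[_]≔_ : Matrix L N → Fin L → (Fin N → Carrier) → Matrix L N
  M [ r ]≔ T = updateAt M r (λ _ → T)

  rowProduct-linear : ∀ (M : Matrix L N) r x (T S : Fin N → Carrier) v →
    rowProduct (M [ r ]≔ (λ c → x * T c + S c)) v ≈ x * rowProduct (M [ r ]≔ T) v + rowProduct (M [ r ]≔ S) v
  rowProduct-linear M zero x T S (a ∷ v) = begin
    (x * T a + S a) * P              ≈⟨ distribʳ P (x * T a) (S a) ⟩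
    x * T a * P + S a * P            ≈⟨ +-congʳ (*-assoc x (T a) P) ⟩
    x * (T a * P) + S a * P          ∎
    where P = rowProduct (M ∘ suc) v
  rowProduct-linear M (suc r) x T S (a ∷ v) = begin
    M zero a * rowProduct (M∘suc [ r ]≔ (λ c → x * T c + S c)) v
      ≈⟨ *-congˡ (rowProduct-linear (M ∘ suc) r x T S v) ⟩
    M zero a * (x * P + Q)                ≈⟨ distribˡ (M zero a) (x * P) Q ⟩
    M zero a * (x * P) + M zero a * Q     ≈⟨ +-congʳ (x∙yz≈y∙xz (M zero a) x P) ⟩
    x * (M zero a * P) + M zero a * Q     ∎
    where
    M∘suc = M ∘ suc
    P = rowProduct (M∘suc [ r ]≔ T) v
    Q = rowProduct (M∘suc [ r ]≔ S) v

  det-linear : ∀ (M : Matrix N N) r x (T S : Fin N → Carrier) →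
    det (M [ r ]≔ (λ c → x * T c + S c)) ≈ x * det (M [ r ]≔ T) + det (M [ r ]≔ S)
  det-linear {N} M r x T S = begin
    ∑ᵛ N (λ v → sign v * rowProduct (M [ r ]≔ (λ c → x * T c + S c)) v)
      ≈⟨ ∑ᵛ-cong N (λ v → trans (*-congˡ (rowProduct-linear M r x T S v)) (distribute (sign v) _ _)) ⟩
    ∑ᵛ N (λ v → x * (sign v * rowProduct (M [ r ]≔ T) v) + sign v * rowProduct (M [ r ]≔ S) v)
      ≈⟨ ∑ᵛ-distrib-+ N _ _ ⟩
    ∑ᵛ N (λ v → x * (sign v * rowProduct (M [ r ]≔ T) v)) + det (M [ r ]≔ S)
      ≈⟨ +-congʳ (*-distribˡ-∑ᵛ N x _) ⟨
    x * det (M [ r ]≔ T) + det (M [ r ]≔ S)  ∎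
    where
    distribute : ∀ s P Q → s * (x * P + Q) ≈ x * (s * P) + s * Q
    distribute s P Q = trans (distribˡ s (x * P) Q) (+-congʳ (x∙yz≈y∙xz s x P))

  swapFin : ℕ → Fin L → Fin L
  swapFin {suc (suc L)} zero zero = suc zero
  swapFin {suc (suc L)} zero (suc zero) = zero
  swapFin {suc (suc L)} zero (suc (suc i)) = suc (suc i)
  swapFin {suc zero} zero zero = zero
  swapFin (suc k) zero = zero
  swapFin (suc k) (suc i) = suc (swapFin k i)

  toℕ-swapFin-here : ∀ k (i : Fin L) → toℕ i ≡ k → suc k < L → toℕ (swapFin k i) ≡ suc k
  toℕ-swapFin-here {suc (suc L)} zero zero ≡.refl _ = ≡.refl
  toℕ-swapFin-here {suc zero} zero zero ≡.refl (s≤s ())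
  toℕ-swapFin-here (suc k) (suc i) i≡k (s≤s k+1<L) = ≡.cong suc (toℕ-swapFin-here k i (ℕP.suc-injective i≡k) k+1<L)

  toℕ-swapFin-next : ∀ k (i : Fin L) → toℕ i ≡ suc k → toℕ (swapFin k i) ≡ k
  toℕ-swapFin-next {suc (suc L)} zero (suc zero) ≡.refl = ≡.refl
  toℕ-swapFin-next {suc zero} zero (suc ()) _
  toℕ-swapFin-next (suc k) (suc i) i≡k+1 = ≡.cong suc (toℕ-swapFin-next k i (ℕP.suc-injective i≡k+1))

  swapFin-other : ∀ k (i : Fin L) → toℕ i ≢ k → toℕ i ≢ suc k → swapFin k i ≡ i
  swapFin-other {suc (suc L)} zero zero i≢k _ = ⊥-elim (i≢k ≡.refl)
  swapFin-other {suc (suc L)} zero (suc zero) _ i≢k+1 = ⊥-elim (i≢k+1 ≡.refl)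
  swapFin-other {suc (suc L)} zero (suc (suc i)) _ _ = ≡.refl
  swapFin-other {suc zero} zero zero _ _ = ≡.refl
  swapFin-other (suc k) zero _ _ = ≡.refl
  swapFin-other (suc k) (suc i) i≢k i≢k+1 =
    ≡.cong suc (swapFin-other k i (i≢k ∘ ≡.cong suc) (i≢k+1 ∘ ≡.cong suc))

  rowProduct-swap : ∀ k (M : Matrix L N) v → rowProduct (M ∘ swapFin k) (swapAt k v) ≈ rowProduct M v
  rowProduct-swap zero M (a ∷ b ∷ w) = x∙yz≈y∙xz _ _ _
  rowProduct-swap zero M [] = refl
  rowProduct-swap zero M (a ∷ []) = refl
  rowProduct-swap (suc k) M [] = refl
  rowProduct-swap (suc k) M (a ∷ w) = *-congˡ (rowProduct-swap k (M ∘ suc) w)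

  det-swapRows : ∀ k (M : Matrix N N) → suc k < N → det (M ∘ swapFin k) ≈ - det M
  det-swapRows {N} k M k+1<N = begin
    det (M ∘ swapFin k)                                          ≈⟨ ∑ᵛ-swapAt k N _ ⟩
    ∑ᵛ N (λ v → sign (swapAt k v) * rowProduct (M ∘ swapFin k) (swapAt k v))
      ≈⟨ ∑ᵛ-cong N (λ v → *-cong (sign-swapAt k v k+1<N) (rowProduct-swap k M v)) ⟩
    ∑ᵛ N (λ v → - sign v * rowProduct M v)      ≈⟨ ∑ᵛ-cong N (λ v → -‿distribˡ-* (sign v) _) ⟨
    ∑ᵛ N (λ v → - (sign v * rowProduct M v))    ≈⟨ -‿distrib-∑ᵛ N _ ⟨
    - det M                                     ∎

  -- The terms cancel in pairs; det M ≈ - det M alone would not give det M ≈ 0# in characteristic 2.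
  det-swapInvariant : ∀ k (M : Matrix N N) → suc k < N → (∀ i c → M (swapFin k i) c ≈ M i c) → det M ≈ 0#
  det-swapInvariant {N} k M k+1<N invariant = ∑ᵛ-antisymmetric k N _ anti fixed
    where
    anti : ∀ v → sign (swapAt k v) * rowProduct M (swapAt k v) ≈ - (sign v * rowProduct M v)
    anti v = begin
      sign (swapAt k v) * rowProduct M (swapAt k v)
        ≈⟨ *-cong (sign-swapAt k v k+1<N) (rowProduct-cong (λ i c → sym (invariant i c)) (swapAt k v)) ⟩
      - sign v * rowProduct (M ∘ swapFin k) (swapAt k v)  ≈⟨ *-congˡ (rowProduct-swap k M v) ⟩
      - sign v * rowProduct M v                           ≈⟨ -‿distribˡ-* (sign v) _ ⟨
      - (sign v * rowProduct M v)                         ∎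
    fixed : ∀ v → swapAt k v ≡ v → sign v * rowProduct M v ≈ 0#
    fixed v fixes = trans (*-congʳ (sign-swapAt-fixed k v k+1<N fixes)) (zeroˡ _)

  private
    det-equalRows-gap : ∀ g (M : Matrix N N) r s → toℕ s ≡ suc (g ℕ.+ toℕ r) → (∀ c → M r c ≈ M s c) → det M ≈ 0#
    det-equalRows-gap zero M r s s≡r+1 rows = det-swapInvariant (toℕ r) M (≡.subst (_< _) s≡r+1 (FP.toℕ<n s)) invariant
      where
      invariant : ∀ i c → M (swapFin (toℕ r) i) c ≈ M i c
      invariant i c with toℕ i ℕ.≟ toℕ r | toℕ i ℕ.≟ suc (toℕ r)
      ... | yes i≡r | _ rewrite FP.toℕ-injective i≡r
        | FP.toℕ-injective (≡.trans (toℕ-swapFin-here (toℕ r) r ≡.refl (≡.subst (_< _) s≡r+1 (FP.toℕ<n s))) (≡.sym s≡r+1))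
        = sym (rows c)
      ... | no _ | yes i≡r+1 rewrite FP.toℕ-injective (≡.trans i≡r+1 (≡.sym s≡r+1))
        | FP.toℕ-injective (toℕ-swapFin-next (toℕ r) s s≡r+1) = rows c
      ... | no i≢r | no i≢r+1 = reflexive (≡.cong (λ i′ → M i′ c) (swapFin-other (toℕ r) i i≢r i≢r+1))
    det-equalRows-gap {N} (suc g) M r s s≡k+1 rows = begin
      det M                      ≈⟨ -‿involutive (det M) ⟨
      - - det M                  ≈⟨ -‿cong (det-swapRows k M k+1<N) ⟨
      - det (M ∘ swapFin k)      ≈⟨ -‿cong (det-equalRows-gap g (M ∘ swapFin k) r s′ (FP.toℕ-fromℕ< k<N) rows′) ⟩
      - 0#                       ≈⟨ -0#≈0# ⟩
      0#                         ∎
      where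
      k = suc (g ℕ.+ toℕ r)
      k+1<N : suc k < N
      k+1<N = ≡.subst (_< N) s≡k+1 (FP.toℕ<n s)
      k<N : k < N
      k<N = ℕP.<-trans (ℕP.n<1+n k) k+1<N
      s′ : Fin N
      s′ = F.fromℕ< k<N
      r<k : toℕ r < k
      r<k = s≤s (ℕP.m≤n+m (toℕ r) g)
      rows′ : ∀ c → M (swapFin k r) c ≈ M (swapFin k s′) c
      rows′ c rewrite swapFin-other k r (ℕP.<⇒≢ r<k) (ℕP.<⇒≢ (ℕP.m<n⇒m<1+n r<k))
        | FP.toℕ-injective {i = swapFin k s′} {j = s} (≡.trans (toℕ-swapFin-here k s′ (FP.toℕ-fromℕ< k<N) k+1<N) (≡.sym s≡k+1))
        = rows c

  private
    gap : ∀ {m n} → m < n → n ≡ suc ((n ℕ.∸ suc m) ℕ.+ m)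
    gap {m} {n} m<n = ≡.trans (≡.sym (ℕP.m∸n+n≡m m<n)) (ℕP.+-suc (n ℕ.∸ suc m) m)

  det-equalRows : (M : Matrix N N) {r s : Fin N} → r ≢ s → (∀ c → M r c ≈ M s c) → det M ≈ 0#
  det-equalRows M {r} {s} r≢s rows with ℕP.<-cmp (toℕ r) (toℕ s)
  ... | tri< r<s _ _ = det-equalRows-gap _ M r s (gap r<s) rows
  ... | tri≈ _ r≡s _ = ⊥-elim (r≢s (FP.toℕ-injective r≡s))
  ... | tri> _ _ s<r = det-equalRows-gap _ M s r (gap s<r) (λ c → sym (rows c))

  updateRow-same : ∀ (M : Matrix L N) r T → (M [ r ]≔ T) r ≡ T
  updateRow-same M r T = VFP.updateAt-updates r M

  updateRow-other : ∀ (M : Matrix L N) {r i} T → i ≢ r → (M [ r ]≔ T) i ≡ M i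
  updateRow-other M {r} {i} T i≢r = VFP.updateAt-minimal i r M i≢r

  det-zeroRow : ∀ (M : Matrix N N) r → det (M [ r ]≔ (λ _ → 0#)) ≈ 0#
  det-zeroRow {N} M r = ∑ᵛ-zero N (λ v → trans (*-congˡ (rowProduct-zero _ v r (entry v))) (zeroʳ _))
    where
    entry : ∀ v → (M [ r ]≔ (λ _ → 0#)) r (lookup v r) ≈ 0#
    entry v = reflexive (≡.cong (λ row → row (lookup v r)) (updateRow-same M r (λ _ → 0#)))

  det-copyRow : (M : Matrix N N) {r s : Fin N} → r ≢ s → det (M [ r ]≔ M s) ≈ 0#
  det-copyRow M {r} {s} r≢s = det-equalRows (M [ r ]≔ M s) r≢s (λ c → reflexive (≡.cong (λ row → row c)
    (≡.trans (updateRow-same M r (M s)) (≡.sym (updateRow-other M (M s) (λ s≡r → r≢s (≡.sym s≡r)))))))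

  det-rowOperation : ∀ (M : Matrix N N) r x (T S : Fin N → Carrier) →
    (∀ c → M r c ≈ x * T c + S c) → det (M [ r ]≔ S) ≈ 0# → det M ≈ x * det (M [ r ]≔ T)
  det-rowOperation M r x T S row detS≈0 = begin
    det M                                                ≈⟨ det-cong entries ⟩
    det (M [ r ]≔ (λ c → x * T c + S c))                 ≈⟨ det-linear M r x T S ⟩
    x * det (M [ r ]≔ T) + det (M [ r ]≔ S)              ≈⟨ +-congˡ detS≈0 ⟩
    x * det (M [ r ]≔ T) + 0#                            ≈⟨ +-identityʳ _ ⟩
    x * det (M [ r ]≔ T)                                 ∎
    where
    entries : ∀ i c → M i c ≈ (M [ r ]≔ (λ c → x * T c + S c)) i c
    entries i c with i F.≟ r
    ... | yes ≡.refl = trans (row c) (reflexive (≡.cong (λ row → row c) (≡.sym (updateRow-same M r _))))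
    ... | no i≢r = reflexive (≡.cong (λ row → row c) (≡.sym (updateRow-other M _ i≢r)))

  product-scale : ∀ (f g : Fin N → Carrier) r x → f r ≈ x * g r → (∀ i → i ≢ r → f i ≈ g i) →
                  product f ≈ x * product g
  product-scale {suc N} f g r x fr≈xgr f≈g = begin
    product f                              ≈⟨ product-remove {i = r} f ⟩
    f r * product (removeAt f r)           ≈⟨ *-cong fr≈xgr (product-cong {N} (λ j → f≈g (F.punchIn r j) (FP.punchInᵢ≢i r j))) ⟩
    x * g r * product (removeAt g r)       ≈⟨ *-assoc x (g r) _ ⟩
    x * (g r * product (removeAt g r))     ≈⟨ *-congˡ (product-remove {i = r} g) ⟨
    x * product g                          ∎

  ReducesTo : (M M′ : Matrix N N) (δ : Fin N → Carrier) → Fin N → Set ℓ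
  ReducesTo M M′ δ r = (∀ c → M r c ≈ δ r * M′ r c)
                     ⊎ ∃ λ s → s F.< r × (∀ c → M r c ≈ δ r * M′ r c + M′ s c)

  private
    if-true : ∀ {a} {A : Set a} {b} {x y : A} → b ≡ true → (if b then x else y) ≡ x
    if-true ≡.refl = ≡.refl

    if-false : ∀ {a} {A : Set a} {b} {x y : A} → b ≡ false → (if b then x else y) ≡ y
    if-false ≡.refl = ≡.refl

  -- Rows are replaced top to bottom: after k steps the rows above k come from M′.
  det-rowReduction : ∀ (M M′ : Matrix N N) δ → (∀ r → ReducesTo M M′ δ r) → det M ≈ product δ * det M′
  det-rowReduction {N} M M′ δ reduces = begin
    det M                              ≈⟨ invariant N ℕP.≤-refl ⟩
    product (scale N) * det (mix N)    ≈⟨ *-cong (product-cong {N} (λ i → reflexive (scaled i)))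
                                                 (det-cong (λ i c → reflexive (≡.cong (λ row → row c) (mixed i)))) ⟩
    product δ * det M′                 ∎
    where
    done : ℕ → Fin N → Bool
    done k i = does (toℕ i ℕ.<? k)
    mix : ℕ → Matrix N N
    mix k i = if done k i then M′ i else M i
    scale : ℕ → Fin N → Carrier
    scale k i = if done k i then δ i else 1#

    mixed : ∀ i → mix N i ≡ M′ i
    mixed i = if-true (dec-true (toℕ i ℕ.<? N) (FP.toℕ<n i))
    scaled : ∀ i → scale N i ≡ δ i
    scaled i = if-true (dec-true (toℕ i ℕ.<? N) (FP.toℕ<n i))
    done-at : ∀ {k} i → toℕ i ≡ k → done k i ≡ false
    done-at i ≡.refl = dec-false (toℕ i ℕ.<? toℕ i) (ℕP.<-irrefl ≡.refl)
    done-step : ∀ {k} i → toℕ i ≢ k → done (suc k) i ≡ done k i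
    done-step {k} i i≢k with ℕP.<-cmp (toℕ i) k
    ... | tri< i<k _ _ = ≡.trans (dec-true (toℕ i ℕ.<? suc k) (ℕP.m<n⇒m<1+n i<k)) (≡.sym (dec-true (toℕ i ℕ.<? k) i<k))
    ... | tri≈ _ i≡k _ = ⊥-elim (i≢k i≡k)
    ... | tri> i≮k _ k<i =
      ≡.trans (dec-false (toℕ i ℕ.<? suc k) (ℕP.<⇒≱ k<i ∘ ℕP.≤-pred)) (≡.sym (dec-false (toℕ i ℕ.<? k) i≮k))

    module Step (k : ℕ) (k<N : k < N) where
      r : Fin N
      r = F.fromℕ< k<N
      r≡k : toℕ r ≡ k
      r≡k = FP.toℕ-fromℕ< k<N
      other : ∀ {i} → i ≢ r → toℕ i ≢ k
      other i≢r i≡k = i≢r (FP.toℕ-injective (≡.trans i≡k (≡.sym r≡k)))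

      pending : mix k r ≡ M r
      pending = if-false (done-at r r≡k)

      advance : ∀ i c → (mix k [ r ]≔ M′ r) i c ≈ mix (suc k) i c
      advance i c with i F.≟ r
      ... | yes ≡.refl = reflexive (≡.cong (λ row → row c)
            (≡.trans (updateRow-same (mix k) r (M′ r)) (≡.sym (if-true (dec-true (toℕ r ℕ.<? suc k) (ℕP.≤-reflexive (≡.cong suc r≡k)))))))
      ... | no i≢r = reflexive (≡.cong (λ row → row c)
            (≡.trans (updateRow-other (mix k) (M′ r) i≢r) (≡.cong (λ b → if b then M′ i else M i) (≡.sym (done-step i (other i≢r))))))

      step : det (mix k) ≈ δ r * det (mix (suc k))
      step = trans (reduce (reduces r)) (*-congˡ (det-cong advance))
        where
        reduce : ReducesTo M M′ δ r → det (mix k) ≈ δ r * det (mix k [ r ]≔ M′ r)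
        reduce (inj₁ scaled) = det-rowOperation (mix k) r (δ r) (M′ r) (λ _ → 0#)
          (λ c → trans (reflexive (≡.cong (λ row → row c) pending)) (trans (scaled c) (sym (+-identityʳ _))))
          (det-zeroRow (mix k) r)
        reduce (inj₂ (s , s<r , row)) = det-rowOperation (mix k) r (δ r) (M′ r) (mix k s)
          (λ c → trans (reflexive (≡.cong (λ row → row c) pending))
                       (trans (row c) (+-congˡ (reflexive (≡.cong (λ row → row c) (≡.sym above))))))
          (det-copyRow (mix k) r≢s)
          where
          above : mix k s ≡ M′ s
          above = if-true (dec-true (toℕ s ℕ.<? k) (≡.subst (toℕ s <_) r≡k s<r))
          r≢s : r ≢ s
          r≢s r≡s = ℕP.<-irrefl (≡.cong toℕ (≡.sym r≡s)) s<r

      rescale : product (scale (suc k)) ≈ δ r * product (scale k)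
      rescale = product-scale (scale (suc k)) (scale k) r (δ r) atRow
        (λ i i≢r → reflexive (≡.cong (λ b → if b then δ i else 1#) (done-step i (other i≢r))))
        where
        atRow : scale (suc k) r ≈ δ r * scale k r
        atRow = begin
          scale (suc k) r  ≡⟨ if-true (dec-true (toℕ r ℕ.<? suc k) (ℕP.≤-reflexive (≡.cong suc r≡k))) ⟩
          δ r              ≈⟨ *-identityʳ (δ r) ⟨
          δ r * 1#         ≡⟨ ≡.cong (δ r *_) (if-false (done-at r r≡k)) ⟨
          δ r * scale k r  ∎

    invariant : ∀ k → k ℕ.≤ N → det M ≈ product (scale k) * det (mix k)
    invariant zero _ = begin
      det M                          ≈⟨ *-identityˡ (det M) ⟨
      1# * det M                     ≈⟨ *-congʳ (product-replicate-one N) ⟨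
      product (scale 0) * det (mix 0)  ∎
    invariant (suc k) k<N = begin
      det M                                          ≈⟨ invariant k (ℕP.<⇒≤ k<N) ⟩
      product (scale k) * det (mix k)                ≈⟨ *-congˡ step ⟩
      product (scale k) * (δ r * det (mix (suc k)))  ≈⟨ x∙yz≈y∙xz _ _ _ ⟩
      δ r * (product (scale k) * det (mix (suc k)))  ≈⟨ *-assoc _ _ _ ⟨
      δ r * product (scale k) * det (mix (suc k))    ≈⟨ *-congʳ rescale ⟨
      product (scale (suc k)) * det (mix (suc k))    ∎
      where open Step k k<N

  ∑ᵛ-avoiding-zero : ∀ L (G : Vec (Fin (suc N)) L → Carrier) → (∀ w i → lookup w i ≡ zero → G w ≈ 0#) →
                     ∑ᵛ L G ≈ ∑ᵛ L (G ∘ V.map suc)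
  ∑ᵛ-avoiding-zero zero G vanishes = refl
  ∑ᵛ-avoiding-zero {N} (suc L) G vanishes = begin
    ∑ᵛ L (λ w → G (zero ∷ w)) + ∑[ b < N ] ∑ᵛ L (λ w → G (suc b ∷ w))
      ≈⟨ +-cong (∑ᵛ-zero L (λ w → vanishes (zero ∷ w) zero ≡.refl))
                (sum-cong-≋ {N} (λ b → ∑ᵛ-avoiding-zero L (λ w → G (suc b ∷ w)) (λ w i → vanishes (suc b ∷ w) (suc i)))) ⟩
    0# + ∑ᵛ (suc L) (G ∘ V.map suc)  ≈⟨ +-identityˡ _ ⟩
    ∑ᵛ (suc L) (G ∘ V.map suc)       ∎

  det-expandFirstColumn : (M : Matrix (suc N) (suc N)) → (∀ i → M (suc i) zero ≈ 0#) →
                          det M ≈ M zero zero * det (λ i j → M (suc i) (suc j))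
  det-expandFirstColumn {N} M belowPivot = begin
    det M                                                     ≡⟨⟩
    ∑ᵛ N (term zero) + ∑[ b < N ] ∑ᵛ N (term (suc b))
      ≈⟨ +-congˡ (trans (sum-cong-≋ {N} (λ b → ∑ᵛ-zero N (offPivot b))) (sum-replicate-zero N)) ⟩
    ∑ᵛ N (term zero) + 0#                                     ≈⟨ +-identityʳ _ ⟩
    ∑ᵛ N (term zero)                                          ≈⟨ ∑ᵛ-avoiding-zero N (term zero) (hitsZero zero) ⟩
    ∑ᵛ N (term zero ∘ V.map suc)                              ≈⟨ ∑ᵛ-cong N pivot ⟩
    ∑ᵛ N (λ u → M zero zero * (sign u * rowProduct minor u))  ≈⟨ *-distribˡ-∑ᵛ N (M zero zero) _ ⟨
    M zero zero * det minor                                   ∎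
    where
    minor : Matrix N N
    minor i j = M (suc i) (suc j)
    term : Fin (suc N) → Vec (Fin (suc N)) N → Carrier
    term a w = sign (a ∷ w) * (M zero a * rowProduct (M ∘ suc) w)
    hitsZero : ∀ a w i → lookup w i ≡ zero → term a w ≈ 0#
    hitsZero a w i wi≡0 = trans (*-congˡ (trans (*-congˡ (rowProduct-zero (M ∘ suc) w i below)) (zeroʳ _))) (zeroʳ _)
      where below = trans (reflexive (≡.cong (M (suc i)) wi≡0)) (belowPivot i)
    offPivot : ∀ b w → term (suc b) w ≈ 0#
    offPivot b w = vanishes (isPerm (suc b ∷ w)) ≡.refl
      where
      vanishes : ∀ p → isPerm (suc b ∷ w) ≡ p → term (suc b) w ≈ 0#
      vanishes false notPerm = trans (*-congʳ (sign-nonPerm (suc b ∷ w) notPerm)) (zeroˡ _)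
      vanishes true isP with perm-surjective (suc b ∷ w) isP zero
      ... | suc i , wi≡0 = hitsZero (suc b) w i wi≡0
    pivot : ∀ u → term zero (V.map suc u) ≈ M zero zero * (sign u * rowProduct minor u)
    pivot u = begin
      sign (zero ∷ V.map suc u) * (M zero zero * rowProduct (M ∘ suc) (V.map suc u))
        ≡⟨ ≡.cong₂ (λ s p → s * (M zero zero * p)) (sign-zero∷suc u) (rowProduct-map-suc (M ∘ suc) u) ⟩
      sign u * (M zero zero * rowProduct minor u)  ≈⟨ x∙yz≈y∙xz _ _ _ ⟩
      M zero zero * (sign u * rowProduct minor u)  ∎

module CompleteHomogeneous {c ℓ} (R : CommutativeRing c ℓ) where

  open CommutativeRing R hiding (zero)
  open import Algebra.Properties.CommutativeSemigroup *-commutativeSemigroup using (x∙yz≈y∙xz)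
  open import Algebra.Properties.CommutativeSemigroup +-commutativeSemigroup
    using (interchange) renaming (x∙yz≈y∙xz to x+[y+z]≈y+[x+z])
  open import Relation.Binary.Reasoning.Setoid setoid

  -- the complete homogeneous symmetric polynomial h_n(zs), the generating function of B(zs, n)
  h : List Carrier → ℕ → Carrier
  h zs zero = 1#
  h [] (suc n) = 0#
  h (z ∷ zs) (suc n) = h zs (suc n) + z * h (z ∷ zs) n

  hℤ : List Carrier → ℤ → Carrier
  hℤ zs (+ n) = h zs n
  hℤ zs -[1+ n ] = 0#

  private
    a≈[a-b]+b : ∀ a b → a ≈ (a - b) + b
    a≈[a-b]+b a b = sym (begin
      (a - b) + b     ≈⟨ +-assoc a (- b) b ⟩
      a + (- b + b)   ≈⟨ +-congˡ (-‿inverseˡ b) ⟩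
      a + 0#          ≈⟨ +-identityʳ a ⟩
      a               ∎)

  h-difference : ∀ W a b U n →
    h (W ++ a ∷ U) (suc n) ≈ (a - b) * h (W ++ b ∷ a ∷ U) n + h (W ++ b ∷ U) (suc n)
  h-difference [] a b U zero = begin
    E + a * 1#                     ≈⟨ +-congˡ (*-congʳ (a≈[a-b]+b a b)) ⟩
    E + (d + b) * 1#               ≈⟨ +-congˡ (distribʳ 1# d b) ⟩
    E + (d * 1# + b * 1#)          ≈⟨ x+[y+z]≈y+[x+z] E _ _ ⟩
    d * 1# + (E + b * 1#)          ∎
    where
    d = a - b
    E = h U 1
  h-difference [] a b U (suc n) = begin
    E + a * A                                  ≈⟨ +-congˡ (*-congʳ (a≈[a-b]+b a b)) ⟩
    E + (d + b) * A                            ≈⟨ +-congˡ (distribʳ A d b) ⟩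
    E + (d * A + b * A)                        ≈⟨ +-congˡ (+-congˡ (*-congˡ (h-difference [] a b U n))) ⟩
    E + (d * A + b * (d * C + B))              ≈⟨ +-congˡ (+-congˡ (distribˡ b (d * C) B)) ⟩
    E + (d * A + (b * (d * C) + b * B))        ≈⟨ +-congˡ (+-congˡ (+-congʳ (x∙yz≈y∙xz b d C))) ⟩
    E + (d * A + (d * (b * C) + b * B))        ≈⟨ +-congˡ (+-assoc _ _ _) ⟨
    E + ((d * A + d * (b * C)) + b * B)        ≈⟨ x+[y+z]≈y+[x+z] E _ _ ⟩
    (d * A + d * (b * C)) + (E + b * B)        ≈⟨ +-congʳ (distribˡ d A (b * C)) ⟨
    d * (A + b * C) + (E + b * B)              ∎
    where
    d = a - b
    E = h U (suc (suc n))
    A = h (a ∷ U) (suc n)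
    B = h (b ∷ U) (suc n)
    C = h (b ∷ a ∷ U) n
  h-difference (w ∷ W) a b U zero = begin
    X + w * 1#                     ≈⟨ +-congʳ (h-difference W a b U zero) ⟩
    ((a - b) * 1# + Y) + w * 1#    ≈⟨ +-assoc _ _ _ ⟩
    (a - b) * 1# + (Y + w * 1#)    ∎
    where
    X = h (W ++ a ∷ U) 1
    Y = h (W ++ b ∷ U) 1
  h-difference (w ∷ W) a b U (suc n) = begin
    h (W ++ a ∷ U) (suc (suc n)) + w * h (w ∷ W ++ a ∷ U) (suc n)
      ≈⟨ +-cong (h-difference W a b U (suc n)) (*-congˡ (h-difference (w ∷ W) a b U n)) ⟩
    (d * X₁ + Y₁) + w * (d * X₂ + Y₂)          ≈⟨ +-congˡ (distribˡ w (d * X₂) Y₂) ⟩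
    (d * X₁ + Y₁) + (w * (d * X₂) + w * Y₂)    ≈⟨ interchange _ _ _ _ ⟩
    (d * X₁ + w * (d * X₂)) + (Y₁ + w * Y₂)    ≈⟨ +-congʳ (+-congˡ (x∙yz≈y∙xz w d X₂)) ⟩
    (d * X₁ + d * (w * X₂)) + (Y₁ + w * Y₂)    ≈⟨ +-congʳ (distribˡ d X₁ (w * X₂)) ⟨
    d * (X₁ + w * X₂) + (Y₁ + w * Y₂)          ∎
    where
    d = a - b
    X₁ = h (W ++ b ∷ a ∷ U) (suc n)
    Y₁ = h (W ++ b ∷ U) (suc (suc n))
    X₂ = h (w ∷ W ++ b ∷ a ∷ U) n
    Y₂ = h (w ∷ W ++ b ∷ U) (suc n)

  hℤ-difference : ∀ W a b U d →
    hℤ (W ++ a ∷ U) d ≈ (a - b) * hℤ (W ++ b ∷ a ∷ U) (d ℤ.- + 1) + hℤ (W ++ b ∷ U) d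
  hℤ-difference W a b U (+ zero) = sym (trans (+-congʳ (zeroʳ (a - b))) (+-identityˡ 1#))
  hℤ-difference W a b U (+ suc n) = h-difference W a b U n
  hℤ-difference W a b U -[1+ n ] = sym (trans (+-congʳ (zeroʳ (a - b))) (+-identityˡ 0#))

[1+m]-[1+n]≡m-n : ∀ j i → + suc j ℤ.- + suc i ≡ + j ℤ.- + i
[1+m]-[1+n]≡m-n j i = ≡.trans (ℤP.[+m]-[+n]≡m⊖n (suc j) (suc i))
  (≡.trans (ℤP.[1+m]⊖[1+n]≡m⊖n j i) (≡.sym (ℤP.[+m]-[+n]≡m⊖n j i)))

m-n-1≡m-[1+n] : ∀ c t → + c ℤ.- + t ℤ.- + 1 ≡ + c ℤ.- + suc t
m-n-1≡m-[1+n] c t = ≡.trans (ℤP.+-comm (+ c ℤ.- + t) (ℤ.- + 1)) (≡.sym (ℤP.minus-suc (+ c) t))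

allFin-suc : ∀ n → L.allFin (suc n) ≡ zero ∷ L.map suc (L.allFin n)
allFin-suc n = ≡.cong (zero ∷_) (≡.sym (LP.map-tabulate (λ i → i) suc))

pairsLT-suc : ∀ n → pairsLT (suc n) ≡ L.map (λ j → zero , suc j) (L.allFin n)
                                     ++ L.map (λ p → suc (proj₁ p) , suc (proj₂ p)) (pairsLT n)
pairsLT-suc n = begin
  L.concatMap (above (suc n)) (L.allFin (suc n))
    ≡⟨ ≡.cong (L.concatMap (above (suc n))) (allFin-suc n) ⟩
  above (suc n) zero ++ L.concatMap (above (suc n)) (L.map suc (L.allFin n))
    ≡⟨ ≡.cong₂ _++_ first (≡.trans (LP.concatMap-map (above (suc n)) suc (L.allFin n)) (LP.concatMap-cong later (L.allFin n))) ⟩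
  L.map (λ j → zero , suc j) (L.allFin n) ++ L.concatMap (L.map shift ∘ above n) (L.allFin n)
    ≡⟨ ≡.cong (L.map (λ j → zero , suc j) (L.allFin n) ++_) (LP.map-concatMap shift (above n) (L.allFin n)) ⟨
  L.map (λ j → zero , suc j) (L.allFin n) ++ L.map shift (pairsLT n)  ∎
  where
  open ≡.≡-Reasoning
  above : ∀ m → Fin m → List (Fin m × Fin m)
  above m i = L.map (i ,_) (L.filter (λ j → toℕ i ℕ.<? toℕ j) (L.allFin m))
  shift : ∀ {m} → Fin m × Fin m → Fin (suc m) × Fin (suc m)
  shift p = suc (proj₁ p) , suc (proj₂ p)
  filter-zero : ∀ (js : List (Fin n)) → L.filter (λ j → 0 ℕ.<? toℕ j) (L.map suc js) ≡ L.map suc js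
  filter-zero [] = ≡.refl
  filter-zero (j ∷ js) = ≡.cong (suc j ∷_) (filter-zero js)
  filter-suc : ∀ i (js : List (Fin n)) →
               L.filter (λ j → suc (toℕ i) ℕ.<? toℕ j) (L.map suc js) ≡ L.map suc (L.filter (λ j → toℕ i ℕ.<? toℕ j) js)
  filter-suc i [] = ≡.refl
  filter-suc i (j ∷ js) with toℕ i ℕ.<ᵇ toℕ j
  ... | true = ≡.cong (suc j ∷_) (filter-suc i js)
  ... | false = filter-suc i js
  first : above (suc n) zero ≡ L.map (λ j → zero , suc j) (L.allFin n)
  first = begin
    above (suc n) zero
      ≡⟨ ≡.cong (λ js → L.map (zero ,_) (L.filter (λ j → 0 ℕ.<? toℕ j) js)) (allFin-suc n) ⟩
    L.map (zero ,_) (L.filter (λ j → 0 ℕ.<? toℕ j) (L.map suc (L.allFin n)))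
      ≡⟨ ≡.cong (L.map (zero ,_)) (filter-zero (L.allFin n)) ⟩
    L.map (zero ,_) (L.map suc (L.allFin n))              ≡⟨ LP.map-∘ (L.allFin n) ⟨
    L.map (λ j → zero , suc j) (L.allFin n)               ∎
  later : ∀ i → above (suc n) (suc i) ≡ L.map shift (above n i)
  later i = begin
    above (suc n) (suc i)
      ≡⟨ ≡.cong (λ js → L.map (suc i ,_) (L.filter (λ j → suc (toℕ i) ℕ.<? toℕ j) js)) (allFin-suc n) ⟩
    L.map (suc i ,_) (L.filter (λ j → suc (toℕ i) ℕ.<? toℕ j) (L.map suc (L.allFin n)))
      ≡⟨ ≡.cong (L.map (suc i ,_)) (filter-suc i (L.allFin n)) ⟩
    L.map (suc i ,_) (L.map suc (L.filter (λ j → toℕ i ℕ.<? toℕ j) (L.allFin n)))  ≡⟨ LP.map-∘ _ ⟨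
    L.map (λ j → suc i , suc j) (L.filter (λ j → toℕ i ℕ.<? toℕ j) (L.allFin n))   ≡⟨ LP.map-∘ _ ⟩
    L.map shift (above n i)                               ∎

module BlockIndex where

  Block : ∀ {n} → Vec ℕ n → Set
  Block {n} α = Σ (Fin n) (λ l → Fin (lookup α l))

  blockRow : ∀ {n} (α : Vec ℕ n) → Block α → Fin (V.sum α)
  blockRow (a ∷ α) (zero , i) = i ↑ˡ V.sum α
  blockRow (a ∷ α) (suc l , i) = a ↑ʳ blockRow α (l , i)

  rowInfo-blockRow : ∀ {n} (α : Vec ℕ n) ρ → rowInfo α (blockRow α ρ) ≡ ρ
  rowInfo-blockRow (a ∷ α) (zero , i) rewrite FP.splitAt-↑ˡ a i (V.sum α) = ≡.refl
  rowInfo-blockRow (a ∷ α) (suc l , i) rewrite FP.splitAt-↑ʳ a (V.sum α) (blockRow α (l , i)) | rowInfo-blockRow α (l , i) = ≡.refl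

  blockRow-rowInfo : ∀ {n} (α : Vec ℕ n) r → blockRow α (rowInfo α r) ≡ r
  blockRow-rowInfo (a ∷ α) r with splitAt a r | FP.join-splitAt a (V.sum α) r
  ... | inj₁ i | joined = joined
  ... | inj₂ r′ | joined = ≡.trans (≡.cong (a ↑ʳ_) (blockRow-rowInfo α r′)) joined

  blockRow-mono : ∀ {n} (α : Vec ℕ n) l {i j} → toℕ i < toℕ j → toℕ (blockRow α (l , i)) < toℕ (blockRow α (l , j))
  blockRow-mono (a ∷ α) zero {i} {j} i<j rewrite FP.toℕ-↑ˡ i (V.sum α) | FP.toℕ-↑ˡ j (V.sum α) = i<j
  blockRow-mono (a ∷ α) (suc l) {i} {j} i<j
    rewrite FP.toℕ-↑ʳ a (blockRow α (l , i)) | FP.toℕ-↑ʳ a (blockRow α (l , j)) = ℕP.+-monoʳ-< a (blockRow-mono α l i<j)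

  shiftBlock : ∀ {n a} {α : Vec ℕ n} → Block (a ∷ α) → Block (suc a ∷ α)
  shiftBlock (zero , i) = zero , suc i
  shiftBlock (suc l , i) = suc l , i

  rowInfo-suc : ∀ {n} a (α : Vec ℕ n) i → rowInfo (suc a ∷ α) (suc i) ≡ shiftBlock (rowInfo (a ∷ α) i)
  rowInfo-suc a α i with splitAt a i
  ... | inj₁ _ = ≡.refl
  ... | inj₂ _ = ≡.refl

  zero⊎predecessor : ∀ {k} (i : Fin k) → toℕ i ≡ 0 ⊎ Σ (Fin k) (λ i′ → toℕ i ≡ suc (toℕ i′))
  zero⊎predecessor zero = inj₁ ≡.refl
  zero⊎predecessor (suc j) = inj₂ (F.inject₁ j , ≡.cong suc (≡.sym (FP.toℕ-inject₁ j)))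

module ConfluentVandermonde {c ℓ} (R : CommutativeRing c ℓ) where

  open CommutativeRing R hiding (zero)
  open import Algebra.Properties.Semiring.Exp semiring using (_^_; ^-homo-*)
  open import Algebra.Properties.CommutativeMonoid.Sum *-commutativeMonoid using ()
    renaming (sum to product; sum-cong-≋ to product-cong; ∑-distrib-+ to product-distrib-*;
              sum-replicate to product-replicate; sum-replicate-zero to product-replicate-one)
  open import Algebra.Properties.CommutativeSemigroup *-commutativeSemigroup using (x∙yz≈y∙xz)
  open import Relation.Binary.Reasoning.Setoid setoid
  open Determinant R
  open CompleteHomogeneous R
  open BlockIndex

  -- row i, column c of M(Y, z, α, m), counting from 0
  blockEntry : ∀ {m} → List Carrier → Carrier → ℕ → Fin m → Carrier
  blockEntry Y z i c = hℤ (Y ++ L.replicate (suc i) z) (+ toℕ c ℤ.- + i)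

  confluent : ∀ {n} → List Carrier → (Fin n → Carrier) → (α : Vec ℕ n) → Matrix (V.sum α) (V.sum α)
  confluent Y x α r = blockEntry Y (x (proj₁ (rowInfo α r))) (toℕ (proj₂ (rowInfo α r)))

  differenceProduct : ∀ {n} → (Fin n → Carrier) → Vec ℕ n → Carrier
  differenceProduct x [] = 1#
  differenceProduct x (a ∷ α) = product (λ l → (x (suc l) - x zero) ^ (a ℕ.* lookup α l)) * differenceProduct (x ∘ suc) α

  product-++ : ∀ m {k} (f : Fin (m ℕ.+ k) → Carrier) → product f ≈ product (λ i → f (i ↑ˡ k)) * product (λ j → f (m ↑ʳ j))
  product-++ zero f = sym (*-identityˡ _)
  product-++ (suc m) f = trans (*-congˡ (product-++ m (f ∘ suc))) (sym (*-assoc (f zero) _ _))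

  product-blocks : ∀ {n} (α : Vec ℕ n) (g : Fin n → Carrier) →
                   product (λ r → g (proj₁ (rowInfo α r))) ≈ product (λ l → g l ^ lookup α l)
  product-blocks [] g = refl
  product-blocks (b ∷ α) g = begin
    product (λ r → g (proj₁ (rowInfo (b ∷ α) r)))
      ≈⟨ product-++ b _ ⟩
    product (λ i → g (proj₁ (rowInfo (b ∷ α) (i ↑ˡ V.sum α)))) * product (λ j → g (proj₁ (rowInfo (b ∷ α) (b ↑ʳ j))))
      ≈⟨ *-cong (product-cong {b} (λ i → reflexive (≡.cong g (firstBlock i))))
                (product-cong {V.sum α} (λ j → reflexive (≡.cong g (laterBlocks j)))) ⟩
    product {b} (λ _ → g zero) * product (λ j → g (suc (proj₁ (rowInfo α j))))
      ≈⟨ *-cong (product-replicate b {g zero}) (product-blocks α (g ∘ suc)) ⟩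
    g zero ^ b * product (λ l → g (suc l) ^ lookup α l)  ∎
    where
    firstBlock : ∀ i → proj₁ (rowInfo (b ∷ α) (i ↑ˡ V.sum α)) ≡ zero
    firstBlock i rewrite FP.splitAt-↑ˡ b i (V.sum α) = ≡.refl
    laterBlocks : ∀ j → proj₁ (rowInfo (b ∷ α) (b ↑ʳ j)) ≡ suc (proj₁ (rowInfo α j))
    laterBlocks j rewrite FP.splitAt-↑ʳ b (V.sum α) j = ≡.refl

  -- Subtracting row i - 1 of the block of z (or, for i = 0, the first row of the matrix,
  -- which belongs to the variable x₀) from row i leaves a multiple of z - x₀.
  blockEntry-difference : ∀ {m} Y x₀ z t (c : Fin m) →
    blockEntry Y z t c ≈ (z - x₀) * hℤ (Y ++ x₀ ∷ L.replicate (suc t) z) (+ toℕ c ℤ.- + suc t)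
                       + hℤ (Y ++ x₀ ∷ L.replicate t z) (+ toℕ c ℤ.- + t)
  blockEntry-difference Y x₀ z t c rewrite ≡.sym (m-n-1≡m-[1+n] (toℕ c) t) =
    hℤ-difference Y z x₀ (L.replicate t z) (+ toℕ c ℤ.- + t)

  module Pivot {n} (Y : List Carrier) (x : Fin (suc n) → Carrier) (a : ℕ) (α : Vec ℕ n) where

    x₀ : Carrier
    x₀ = x zero

    M : Matrix (suc (a ℕ.+ V.sum α)) (suc (a ℕ.+ V.sum α))
    M = confluent Y x (suc a ∷ α)

    -- the rows of the later blocks after the reduction: x₀ joins the variables, one column to the right
    shiftedEntry : ∀ {m} → Carrier → ℕ → Fin m → Carrier
    shiftedEntry z i c = hℤ (Y ++ x₀ ∷ L.replicate (suc i) z) (+ toℕ c ℤ.- + suc i)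

    reducedRow : Block (suc a ∷ α) → Fin (suc (a ℕ.+ V.sum α)) → Carrier
    reducedRow (zero , i) = blockEntry Y x₀ (toℕ i)
    reducedRow (suc l , i) = shiftedEntry (x (suc l)) (toℕ i)

    reduced : Matrix (suc (a ℕ.+ V.sum α)) (suc (a ℕ.+ V.sum α))
    reduced r = reducedRow (rowInfo (suc a ∷ α) r)

    factor : Fin (suc n) → Carrier
    factor zero = 1#
    factor (suc l) = x (suc l) - x₀

    reduces : ∀ r → ReducesTo M reduced (factor ∘ proj₁ ∘ rowInfo (suc a ∷ α)) r
    reduces r = fromBlock (rowInfo (suc a ∷ α) r) (blockRow-rowInfo (suc a ∷ α) r)
      where
      fromBlock : ∀ ρ → blockRow (suc a ∷ α) ρ ≡ r →
                  (∀ c → blockEntry Y (x (proj₁ ρ)) (toℕ (proj₂ ρ)) c ≈ factor (proj₁ ρ) * reducedRow ρ c)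
                  ⊎ ∃ λ s → s F.< r × (∀ c → blockEntry Y (x (proj₁ ρ)) (toℕ (proj₂ ρ)) c
                                                ≈ factor (proj₁ ρ) * reducedRow ρ c + reduced s c)
      fromBlock (zero , i) _ = inj₁ (λ c → sym (*-identityˡ _))
      fromBlock (suc l , i) ≡.refl with zero⊎predecessor i
      ... | inj₁ i≡0 = inj₂ (zero , s≤s z≤n , firstRow)
        where
        firstRow : ∀ c → blockEntry Y (x (suc l)) (toℕ i) c ≈ factor (suc l) * shiftedEntry (x (suc l)) (toℕ i) c + reduced zero c
        firstRow c rewrite i≡0 = blockEntry-difference Y x₀ (x (suc l)) 0 c
      ... | inj₂ (i′ , i≡i′+1) = inj₂ (blockRow (suc a ∷ α) (suc l , i′) , earlier , previousRow)
        where
        earlier : toℕ (blockRow (suc a ∷ α) (suc l , i′)) < toℕ (blockRow (suc a ∷ α) (suc l , i))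
        earlier = blockRow-mono (suc a ∷ α) (suc l) (≡.subst (toℕ i′ <_) (≡.sym i≡i′+1) (ℕP.n<1+n (toℕ i′)))
        previousRow : ∀ c → blockEntry Y (x (suc l)) (toℕ i) c
                            ≈ factor (suc l) * shiftedEntry (x (suc l)) (toℕ i) c + reduced (blockRow (suc a ∷ α) (suc l , i′)) c
        previousRow c rewrite rowInfo-blockRow (suc a ∷ α) (suc l , i′) | i≡i′+1 =
          blockEntry-difference Y x₀ (x (suc l)) (suc (toℕ i′)) c

    below-pivot : ∀ i → reduced (suc i) zero ≈ 0#
    below-pivot i rewrite rowInfo-suc a α i with rowInfo (a ∷ α) i
    ... | zero , _ = refl
    ... | suc _ , _ = refl

    minor : ∀ i j → reduced (suc i) (suc j) ≈ confluent (Y ++ x₀ ∷ []) x (a ∷ α) i j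
    minor i j rewrite rowInfo-suc a α i with rowInfo (a ∷ α) i
    ... | zero , i′ = reflexive (≡.cong₂ hℤ (≡.sym (LP.++-assoc Y (x₀ ∷ []) _)) ([1+m]-[1+n]≡m-n (toℕ j) (toℕ i′)))
    ... | suc l , i′ = reflexive (≡.cong₂ hℤ (≡.sym (LP.++-assoc Y (x₀ ∷ []) _)) ([1+m]-[1+n]≡m-n (toℕ j) (toℕ i′)))

    factors : product (factor ∘ proj₁ ∘ rowInfo (suc a ∷ α)) ≈ product (λ l → (x (suc l) - x₀) ^ lookup α l)
    factors = begin
      product (factor ∘ proj₁ ∘ rowInfo (suc a ∷ α))                 ≈⟨ product-blocks (suc a ∷ α) factor ⟩
      1# ^ suc a * product (λ l → (x (suc l) - x₀) ^ lookup α l)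
        ≈⟨ *-congʳ (trans (sym (product-replicate (suc a))) (product-replicate-one (suc a))) ⟩
      1# * product (λ l → (x (suc l) - x₀) ^ lookup α l)             ≈⟨ *-identityˡ _ ⟩
      product (λ l → (x (suc l) - x₀) ^ lookup α l)                  ∎

    det-pivot : det M ≈ product (λ l → (x (suc l) - x₀) ^ lookup α l) * det (confluent (Y ++ x₀ ∷ []) x (a ∷ α))
    det-pivot = begin
      det M                                                   ≈⟨ det-rowReduction M reduced _ reduces ⟩
      product (factor ∘ proj₁ ∘ rowInfo (suc a ∷ α)) * det reduced
        ≈⟨ *-cong factors (det-expandFirstColumn reduced below-pivot) ⟩
      P * (1# * det (λ i j → reduced (suc i) (suc j)))        ≈⟨ *-congˡ (*-identityˡ _) ⟩
      P * det (λ i j → reduced (suc i) (suc j))               ≈⟨ *-congˡ (det-cong minor) ⟩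
      P * det (confluent (Y ++ x₀ ∷ []) x (a ∷ α))            ∎
      where P = product (λ l → (x (suc l) - x₀) ^ lookup α l)

  mutual
    det-confluent : ∀ {n} (Y : List Carrier) (x : Fin n → Carrier) (α : Vec ℕ n) →
                    det (confluent Y x α) ≈ differenceProduct x α
    det-confluent Y x [] = *-identityˡ 1#
    det-confluent Y x (a ∷ α) = det-confluent-∷ Y x a α

    det-confluent-∷ : ∀ {n} (Y : List Carrier) (x : Fin (suc n) → Carrier) a (α : Vec ℕ n) →
                      det (confluent Y x (a ∷ α)) ≈ differenceProduct x (a ∷ α)
    det-confluent-∷ {n} Y x zero α = begin
      det (confluent Y (x ∘ suc) α)           ≈⟨ det-confluent Y (x ∘ suc) α ⟩
      differenceProduct (x ∘ suc) α           ≈⟨ *-identityˡ _ ⟨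
      1# * differenceProduct (x ∘ suc) α      ≈⟨ *-congʳ (product-replicate-one n) ⟨
      differenceProduct x (zero ∷ α)          ∎
    det-confluent-∷ Y x (suc a) α = begin
      det (confluent Y x (suc a ∷ α))                                    ≈⟨ Pivot.det-pivot Y x a α ⟩
      product (λ l → d l ^ lookup α l) * det (confluent (Y ++ x zero ∷ []) x (a ∷ α))
        ≈⟨ *-congˡ (det-confluent-∷ (Y ++ x zero ∷ []) x a α) ⟩
      product (λ l → d l ^ lookup α l) * (product (λ l → d l ^ (a ℕ.* lookup α l)) * rest)
        ≈⟨ *-assoc _ _ rest ⟨
      (product (λ l → d l ^ lookup α l) * product (λ l → d l ^ (a ℕ.* lookup α l))) * rest
        ≈⟨ *-congʳ (trans (product-cong (λ l → ^-homo-* (d l) (lookup α l) (a ℕ.* lookup α l)))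
                          (product-distrib-* (λ l → d l ^ lookup α l) (λ l → d l ^ (a ℕ.* lookup α l)))) ⟨
      differenceProduct x (suc a ∷ α)                                    ∎
      where
      d : Fin _ → Carrier
      d l = x (suc l) - x zero
      rest = differenceProduct (x ∘ suc) α

  listProduct : List Carrier → Carrier
  listProduct = L.foldr _*_ 1#

  listProduct-++ : ∀ xs ys → listProduct (xs ++ ys) ≈ listProduct xs * listProduct ys
  listProduct-++ [] ys = sym (*-identityˡ _)
  listProduct-++ (x ∷ xs) ys = trans (*-congˡ (listProduct-++ xs ys)) (sym (*-assoc x _ _))

  listProduct-allFin : ∀ {n} (f : Fin n → Carrier) → listProduct (L.map f (L.allFin n)) ≡ product f
  listProduct-allFin {n} f = ≡.trans (≡.cong listProduct (LP.map-tabulate (λ i → i) f)) (tabulated f)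
    where
    tabulated : ∀ {m} (g : Fin m → Carrier) → listProduct (L.tabulate g) ≡ product g
    tabulated {zero} g = ≡.refl
    tabulated {suc m} g = ≡.cong (g zero *_) (tabulated (g ∘ suc))

  pairFactor : ∀ {n} → (Fin n → Carrier) → Vec ℕ n → Fin n × Fin n → Carrier
  pairFactor x α (i , j) = (x j - x i) ^ (lookup α i ℕ.* lookup α j)

  differenceProduct-pairsLT : ∀ {n} (x : Fin n → Carrier) (α : Vec ℕ n) →
                              listProduct (L.map (pairFactor x α) (pairsLT n)) ≈ differenceProduct x α
  differenceProduct-pairsLT x [] = refl
  differenceProduct-pairsLT {suc n} x (a ∷ α) = begin
    listProduct (L.map (pairFactor x (a ∷ α)) (pairsLT (suc n)))
      ≡⟨ ≡.cong (listProduct ∘ L.map (pairFactor x (a ∷ α))) (pairsLT-suc n) ⟩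
    listProduct (L.map (pairFactor x (a ∷ α)) (firstRow ++ L.map shift (pairsLT n)))
      ≡⟨ ≡.cong listProduct (LP.map-++ (pairFactor x (a ∷ α)) firstRow (L.map shift (pairsLT n))) ⟩
    listProduct (L.map (pairFactor x (a ∷ α)) firstRow ++ L.map (pairFactor x (a ∷ α)) (L.map shift (pairsLT n)))
      ≈⟨ listProduct-++ (L.map (pairFactor x (a ∷ α)) firstRow) _ ⟩
    listProduct (L.map (pairFactor x (a ∷ α)) firstRow) * listProduct (L.map (pairFactor x (a ∷ α)) (L.map shift (pairsLT n)))
      ≡⟨ ≡.cong₂ _*_ (≡.trans (≡.cong listProduct (≡.sym (LP.map-∘ (L.allFin n))))
                              (listProduct-allFin (λ l → (x (suc l) - x zero) ^ (a ℕ.* lookup α l))))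
                     (≡.cong listProduct (≡.sym (LP.map-∘ (pairsLT n)))) ⟩
    product (λ l → (x (suc l) - x zero) ^ (a ℕ.* lookup α l)) * listProduct (L.map (pairFactor (x ∘ suc) α) (pairsLT n))
      ≈⟨ *-congˡ (differenceProduct-pairsLT (x ∘ suc) α) ⟩
    differenceProduct x (a ∷ α)  ∎
    where
    firstRow = L.map (λ j → zero , suc j) (L.allFin n)
    shift : Fin n × Fin n → Fin (suc n) × Fin (suc n)
    shift p = suc (proj₁ p) , suc (proj₂ p)


open Defs
open ≡ using (refl; sym; trans; cong; cong₂; subst; module ≡-Reasoning)
open import Data.Integer using () renaming (_+_ to _+ℤ_; _*_ to _*ℤ_; -_ to -ℤ_)
open CommutativeSemigroupProperties ℤP.+-commutativeSemigroup using (interchange; x∙yz≈y∙xz)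

sumℤ : ∀ {A : Set} → List A → (A → ℤ) → ℤ
sumℤ xs f = L.foldr (λ x s → f x +ℤ s) (+ 0) xs

sumℤ-++ : ∀ {A : Set} (xs ys : List A) f → sumℤ (xs ++ ys) f ≡ sumℤ xs f +ℤ sumℤ ys f
sumℤ-++ [] ys f = sym (ℤP.+-identityˡ _)
sumℤ-++ (x ∷ xs) ys f = trans (cong (f x +ℤ_) (sumℤ-++ xs ys f)) (sym (ℤP.+-assoc (f x) _ _))

sumℤ-cong : ∀ {A : Set} (xs : List A) {f g} → (∀ x → f x ≡ g x) → sumℤ xs f ≡ sumℤ xs g
sumℤ-cong [] f≡g = refl
sumℤ-cong (x ∷ xs) f≡g = cong₂ _+ℤ_ (f≡g x) (sumℤ-cong xs f≡g)

sumℤ-map : ∀ {A B : Set} (xs : List A) (g : A → B) f → sumℤ (L.map g xs) f ≡ sumℤ xs (λ x → f (g x))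
sumℤ-map [] g f = refl
sumℤ-map (x ∷ xs) g f = cong (f (g x) +ℤ_) (sumℤ-map xs g f)

sumℤ-concatMap : ∀ {A B : Set} (xs : List A) (g : A → List B) f →
                 sumℤ (concatMap g xs) f ≡ sumℤ xs (λ x → sumℤ (g x) f)
sumℤ-concatMap [] g f = refl
sumℤ-concatMap (x ∷ xs) g f = trans (sumℤ-++ (g x) _ f) (cong (sumℤ (g x) f +ℤ_) (sumℤ-concatMap xs g f))

sumℤ-distrib-+ : ∀ {A : Set} (xs : List A) f g → sumℤ xs (λ x → f x +ℤ g x) ≡ sumℤ xs f +ℤ sumℤ xs g
sumℤ-distrib-+ [] f g = refl
sumℤ-distrib-+ (x ∷ xs) f g = trans (cong (f x +ℤ g x +ℤ_) (sumℤ-distrib-+ xs f g)) (interchange (f x) (g x) _ _)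

sumℤ-zero : ∀ {A : Set} (xs : List A) → sumℤ xs (λ _ → + 0) ≡ + 0
sumℤ-zero [] = refl
sumℤ-zero (x ∷ xs) = trans (ℤP.+-identityˡ _) (sumℤ-zero xs)

sumℤ-*ˡ : ∀ {A : Set} (xs : List A) c f → sumℤ xs (λ x → c *ℤ f x) ≡ c *ℤ sumℤ xs f
sumℤ-*ˡ [] c f = sym (ℤP.*-zeroʳ c)
sumℤ-*ˡ (x ∷ xs) c f = trans (cong (c *ℤ f x +ℤ_) (sumℤ-*ˡ xs c f)) (sym (ℤP.*-distribˡ-+ c (f x) _))

sumℤ-neg : ∀ {A : Set} (xs : List A) f → sumℤ xs (λ x → -ℤ f x) ≡ -ℤ sumℤ xs f
sumℤ-neg [] f = refl
sumℤ-neg (x ∷ xs) f = trans (cong (-ℤ f x +ℤ_) (sumℤ-neg xs f)) (sym (ℤP.neg-distrib-+ (f x) _))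

sumℤ-comm : ∀ {A B : Set} (xs : List A) (ys : List B) (f : A → B → ℤ) →
            sumℤ xs (λ x → sumℤ ys (f x)) ≡ sumℤ ys (λ y → sumℤ xs (λ x → f x y))
sumℤ-comm [] ys f = sym (sumℤ-zero ys)
sumℤ-comm (x ∷ xs) ys f = trans (cong (sumℤ ys (f x) +ℤ_) (sumℤ-comm xs ys f))
                                (sym (sumℤ-distrib-+ ys (f x) (λ y → sumℤ xs (λ x′ → f x′ y))))

signℤ : Bool → ℤ
signℤ false = + 1
signℤ true = -[1+ 0 ]

signℤ-not : ∀ s → signℤ (not s) ≡ -ℤ signℤ s
signℤ-not false = refl
signℤ-not true = refl

signℤ-xor : ∀ s t → signℤ (s xor t) ≡ signℤ s *ℤ signℤ t
signℤ-xor false t = sym (ℤP.*-identityˡ (signℤ t))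
signℤ-xor true false = refl
signℤ-xor true true = refl

residual : ∀ {n} → Vec ℕ n → Vec ℕ n → Maybe (Vec ℕ n)
residual [] [] = just []
residual (x ∷ xs) (e ∷ es) with x ℕ.≤? e | residual xs es
... | yes _ | just r = just ((e ℕ.∸ x) ∷ r)
... | yes _ | nothing = nothing
... | no _ | _ = nothing

residual-sound : ∀ {n} (x r e : Vec ℕ n) → residual x e ≡ just r → V.zipWith ℕ._+_ x r ≡ e
residual-sound [] [] [] eq = refl
residual-sound (x ∷ xs) (r ∷ rs) (e ∷ es) eq with x ℕ.≤? e | residual xs es in eqs
residual-sound (x ∷ xs) (r ∷ rs) (e ∷ es) refl | yes x≤e | just _ =
  cong₂ _∷_ (ℕP.m+[n∸m]≡n x≤e) (residual-sound xs rs es eqs)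

residual-complete : ∀ {n} (x r e : Vec ℕ n) → V.zipWith ℕ._+_ x r ≡ e → residual x e ≡ just r
residual-complete [] [] [] eq = refl
residual-complete (x ∷ xs) (r ∷ rs) (.(x ℕ.+ r) ∷ .(V.zipWith ℕ._+_ xs rs)) refl
  with x ℕ.≤? x ℕ.+ r | residual xs (V.zipWith ℕ._+_ xs rs) | residual-complete xs rs _ refl
... | yes _ | just _ | refl = cong (λ d → just (d ∷ rs)) (ℕP.m+n∸m≡n x r)
... | no x≰x+r | _ | _ = ⊥-elim (x≰x+r (ℕP.m≤m+n x r))

module _ {V : ℕ} where

  w*-comm : ∀ (a b : Weight V) → a w* b ≡ b w* a
  w*-comm (s , x) (t , y) = cong₂ _,_ (BP.xor-comm s t) (VP.zipWith-comm ℕP.+-comm x y)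

  w*-assoc : ∀ (a b c : Weight V) → (a w* b) w* c ≡ a w* (b w* c)
  w*-assoc (s , x) (t , y) (u , z) = cong₂ _,_ (BP.xor-assoc s t u) (VP.zipWith-assoc ℕP.+-assoc x y z)

  wone-w* : ∀ (a : Weight V) → wone w* a ≡ a
  wone-w* (s , x) = cong (s ,_) (VP.zipWith-identityˡ (λ _ → refl) x)

-- ℤ[x₁, …, x_V] as lists of signed monomials, identified when all coefficients agree
module Polynomials (V : ℕ) where

  Poly : Set
  Poly = List (Weight V)

  _≟ᵉ_ : (a b : Vec ℕ V) → Dec (a ≡ b)
  _≟ᵉ_ = VP.≡-dec ℕ._≟_

  termCoefficient : Vec ℕ V → Weight V → ℤ
  termCoefficient e (s , a) with a ≟ᵉ e
  ... | yes _ = signℤ s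
  ... | no _ = + 0

  coefficient : Vec ℕ V → Poly → ℤ
  coefficient e p = sumℤ p (termCoefficient e)

  infix 4 _≈_
  record _≈_ (p q : Poly) : Set where
    constructor mk≈
    field coefficients : ∀ e → coefficient e p ≡ coefficient e q
  open _≈_ public

  0ᴾ 1ᴾ : Poly
  0ᴾ = []
  1ᴾ = wone ∷ []

  infixl 6 _+ᴾ_
  infixl 7 _*ᴾ_
  _+ᴾ_ : Poly → Poly → Poly
  _+ᴾ_ = _++_

  -ᴾ_ : Poly → Poly
  -ᴾ_ = L.map wneg

  _*ᴾ_ : Poly → Poly → Poly
  p *ᴾ q = concatMap (λ a → L.map (a w*_) q) p

  termCoefficient-neg : ∀ e a → termCoefficient e (wneg a) ≡ -ℤ termCoefficient e a
  termCoefficient-neg e (s , x) with x ≟ᵉ e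
  ... | yes _ = signℤ-not s
  ... | no _ = refl

  coefficient-+ : ∀ e p q → coefficient e (p +ᴾ q) ≡ coefficient e p +ℤ coefficient e q
  coefficient-+ e p q = sumℤ-++ p q (termCoefficient e)

  coefficient-neg : ∀ e p → coefficient e (-ᴾ p) ≡ -ℤ coefficient e p
  coefficient-neg e p = trans (sumℤ-map p wneg (termCoefficient e))
    (trans (sumℤ-cong p (termCoefficient-neg e)) (sumℤ-neg p (termCoefficient e)))

  sumℤ-* : ∀ p q (f : Weight V → ℤ) → sumℤ (p *ᴾ q) f ≡ sumℤ p (λ a → sumℤ q (λ b → f (a w* b)))
  sumℤ-* p q f = trans (sumℤ-concatMap p (λ a → L.map (a w*_) q) f) (sumℤ-cong p (λ a → sumℤ-map q (a w*_) f))

  coefficient-* : ∀ e p q → coefficient e (p *ᴾ q) ≡ sumℤ p (λ a → sumℤ q (λ b → termCoefficient e (a w* b)))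
  coefficient-* e p q = sumℤ-* p q (termCoefficient e)

  monomial-* : ∀ a q → (a ∷ []) *ᴾ q ≈ L.map (a w*_) q
  monomial-* a q = mk≈ λ e → cong (coefficient e) (LP.++-identityʳ (L.map (a w*_) q))

  scaledCoefficient : Maybe (Vec ℕ V) → Bool → Poly → ℤ
  scaledCoefficient (just r) s q = signℤ s *ℤ coefficient r q
  scaledCoefficient nothing s q = + 0

  -- Multiplying by a monomial of exponent x shifts coefficients by x; this makes _*ᴾ_ respect _≈_.
  coefficient-monomial-* : ∀ e s x q → sumℤ q (λ b → termCoefficient e ((s , x) w* b)) ≡ scaledCoefficient (residual x e) s q
  coefficient-monomial-* e s x q with residual x e in res
  ... | just r = trans (sumℤ-cong q term) (sumℤ-*ˡ q (signℤ s) (termCoefficient r))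
    where
    term : ∀ b → termCoefficient e ((s , x) w* b) ≡ signℤ s *ℤ termCoefficient r b
    term (t , y) with V.zipWith ℕ._+_ x y ≟ᵉ e | y ≟ᵉ r
    ... | yes _ | yes _ = signℤ-xor s t
    ... | yes x+y≡e | no y≢r = ⊥-elim (y≢r (MaybeP.just-injective (trans (sym (residual-complete x y e x+y≡e)) res)))
    ... | no x+y≢e | yes refl = ⊥-elim (x+y≢e (residual-sound x y e res))
    ... | no _ | no _ = sym (ℤP.*-zeroʳ (signℤ s))
  ... | nothing = trans (sumℤ-cong q term) (sumℤ-zero q)
    where
    term : ∀ b → termCoefficient e ((s , x) w* b) ≡ + 0
    term (t , y) with V.zipWith ℕ._+_ x y ≟ᵉ e
    ... | yes x+y≡e with () ← trans (sym res) (residual-complete x y e x+y≡e)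
    ... | no _ = refl

  ≈-refl : ∀ {p} → p ≈ p
  ≈-refl = mk≈ λ e → refl

  ≈-sym : ∀ {p q} → p ≈ q → q ≈ p
  ≈-sym p≈q = mk≈ λ e → sym (coefficients p≈q e)

  ≈-trans : ∀ {p q r} → p ≈ q → q ≈ r → p ≈ r
  ≈-trans p≈q q≈r = mk≈ λ e → trans (coefficients p≈q e) (coefficients q≈r e)

  +-cong : ∀ {p p′ q q′} → p ≈ p′ → q ≈ q′ → p +ᴾ q ≈ p′ +ᴾ q′
  +-cong {p} {p′} {q} {q′} p≈p′ q≈q′ = mk≈ λ e → trans (coefficient-+ e p q)
    (trans (cong₂ _+ℤ_ (coefficients p≈p′ e) (coefficients q≈q′ e)) (sym (coefficient-+ e p′ q′)))

  -‿cong : ∀ {p q} → p ≈ q → -ᴾ p ≈ -ᴾ q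
  -‿cong {p} {q} p≈q = mk≈ λ e → trans (coefficient-neg e p) (trans (cong -ℤ_ (coefficients p≈q e)) (sym (coefficient-neg e q)))

  +-assoc : ∀ p q r → (p +ᴾ q) +ᴾ r ≈ p +ᴾ (q +ᴾ r)
  +-assoc p q r = mk≈ λ e → cong (coefficient e) (LP.++-assoc p q r)

  +-comm : ∀ p q → p +ᴾ q ≈ q +ᴾ p
  +-comm p q = mk≈ λ e → trans (coefficient-+ e p q) (trans (ℤP.+-comm (coefficient e p) _) (sym (coefficient-+ e q p)))

  +-identityˡ : ∀ p → 0ᴾ +ᴾ p ≈ p
  +-identityˡ p = ≈-refl

  +-identityʳ : ∀ p → p +ᴾ 0ᴾ ≈ p
  +-identityʳ p = mk≈ λ e → cong (coefficient e) (LP.++-identityʳ p)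

  -‿inverseʳ : ∀ p → p +ᴾ -ᴾ p ≈ 0ᴾ
  -‿inverseʳ p = mk≈ λ e → trans (coefficient-+ e p (-ᴾ p))
    (trans (cong (coefficient e p +ℤ_) (coefficient-neg e p)) (ℤP.+-inverseʳ (coefficient e p)))

  -‿inverseˡ : ∀ p → -ᴾ p +ᴾ p ≈ 0ᴾ
  -‿inverseˡ p = ≈-trans (+-comm (-ᴾ p) p) (-‿inverseʳ p)

  *-congˡ : ∀ {p q q′} → q ≈ q′ → p *ᴾ q ≈ p *ᴾ q′
  *-congˡ {p} {q} {q′} q≈q′ = mk≈ λ e → trans (coefficient-* e p q)
    (trans (sumℤ-cong p (λ { (s , x) → trans (coefficient-monomial-* e s x q)
                                           (trans (scaled (residual x e) s) (sym (coefficient-monomial-* e s x q′))) }))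
           (sym (coefficient-* e p q′)))
    where
    scaled : ∀ r s → scaledCoefficient r s q ≡ scaledCoefficient r s q′
    scaled (just r) s = cong (signℤ s *ℤ_) (coefficients q≈q′ r)
    scaled nothing s = refl

  *-comm : ∀ p q → p *ᴾ q ≈ q *ᴾ p
  *-comm p q = mk≈ λ e → trans (coefficient-* e p q) (trans (sumℤ-comm p q (λ a b → termCoefficient e (a w* b)))
    (trans (sumℤ-cong q (λ b → sumℤ-cong p (λ a → cong (termCoefficient e) (w*-comm a b)))) (sym (coefficient-* e q p))))

  *-cong : ∀ {p p′ q q′} → p ≈ p′ → q ≈ q′ → p *ᴾ q ≈ p′ *ᴾ q′
  *-cong {p} {p′} {q} {q′} p≈p′ q≈q′ =
    ≈-trans (*-comm p q) (≈-trans (*-congˡ {q} p≈p′) (≈-trans (*-comm q p′) (*-congˡ {p′} q≈q′)))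

  *-assoc : ∀ p q r → (p *ᴾ q) *ᴾ r ≈ p *ᴾ (q *ᴾ r)
  *-assoc p q r = mk≈ λ e → begin
    coefficient e ((p *ᴾ q) *ᴾ r)                                                 ≡⟨ coefficient-* e (p *ᴾ q) r ⟩
    sumℤ (p *ᴾ q) (λ ab → sumℤ r (λ c → termCoefficient e (ab w* c)))
      ≡⟨ sumℤ-* p q (λ ab → sumℤ r (λ c → termCoefficient e (ab w* c))) ⟩
    sumℤ p (λ a → sumℤ q (λ b → sumℤ r (λ c → termCoefficient e ((a w* b) w* c))))
      ≡⟨ sumℤ-cong p (λ a → sumℤ-cong q (λ b → sumℤ-cong r (λ c → cong (termCoefficient e) (w*-assoc a b c)))) ⟩
    sumℤ p (λ a → sumℤ q (λ b → sumℤ r (λ c → termCoefficient e (a w* (b w* c)))))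
      ≡⟨ sumℤ-cong p (λ a → sumℤ-* q r (λ bc → termCoefficient e (a w* bc))) ⟨
    sumℤ p (λ a → sumℤ (q *ᴾ r) (λ bc → termCoefficient e (a w* bc)))            ≡⟨ coefficient-* e p (q *ᴾ r) ⟨
    coefficient e (p *ᴾ (q *ᴾ r))                                                 ∎
    where open ≡-Reasoning

  *-identityˡ : ∀ p → 1ᴾ *ᴾ p ≈ p
  *-identityˡ p = mk≈ λ e → trans (coefficient-* e 1ᴾ p)
    (trans (ℤP.+-identityʳ _) (sumℤ-cong p (λ b → cong (termCoefficient e) (wone-w* b))))

  *-identityʳ : ∀ p → p *ᴾ 1ᴾ ≈ p
  *-identityʳ p = ≈-trans (*-comm p 1ᴾ) (*-identityˡ p)

  distribˡ : ∀ p q r → p *ᴾ (q +ᴾ r) ≈ p *ᴾ q +ᴾ p *ᴾ r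
  distribˡ p q r = mk≈ λ e → begin
    coefficient e (p *ᴾ (q +ᴾ r))                                  ≡⟨ coefficient-* e p (q +ᴾ r) ⟩
    sumℤ p (λ a → sumℤ (q ++ r) (λ b → termCoefficient e (a w* b)))
      ≡⟨ sumℤ-cong p (λ a → sumℤ-++ q r (λ b → termCoefficient e (a w* b))) ⟩
    sumℤ p (λ a → sumℤ q (λ b → termCoefficient e (a w* b)) +ℤ sumℤ r (λ b → termCoefficient e (a w* b)))
      ≡⟨ sumℤ-distrib-+ p (λ a → sumℤ q (λ b → termCoefficient e (a w* b)))
                          (λ a → sumℤ r (λ b → termCoefficient e (a w* b))) ⟩
    sumℤ p (λ a → sumℤ q (λ b → termCoefficient e (a w* b))) +ℤ sumℤ p (λ a → sumℤ r (λ b → termCoefficient e (a w* b)))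
      ≡⟨ cong₂ _+ℤ_ (coefficient-* e p q) (coefficient-* e p r) ⟨
    coefficient e (p *ᴾ q) +ℤ coefficient e (p *ᴾ r)               ≡⟨ coefficient-+ e (p *ᴾ q) (p *ᴾ r) ⟨
    coefficient e (p *ᴾ q +ᴾ p *ᴾ r)                               ∎
    where open ≡-Reasoning

  distribʳ : ∀ p q r → (q +ᴾ r) *ᴾ p ≈ q *ᴾ p +ᴾ r *ᴾ p
  distribʳ p q r = ≈-trans (*-comm (q +ᴾ r) p) (≈-trans (distribˡ p q r) (+-cong (*-comm p q) (*-comm p r)))

  isCommutativeRing : IsCommutativeRing _≈_ _+ᴾ_ _*ᴾ_ -ᴾ_ 0ᴾ 1ᴾ
  isCommutativeRing = record
    { isRing = record
      { +-isAbelianGroup = record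
        { isGroup = record
          { isMonoid = record
            { isSemigroup = record
              { isMagma = record
                { isEquivalence = record { refl = ≈-refl ; sym = ≈-sym ; trans = ≈-trans }
                ; ∙-cong = +-cong }
              ; assoc = +-assoc }
            ; identity = +-identityˡ , +-identityʳ }
          ; inverse = -‿inverseˡ , -‿inverseʳ
          ; ⁻¹-cong = -‿cong }
        ; comm = +-comm }
      ; *-cong = *-cong
      ; *-assoc = *-assoc
      ; *-identity = *-identityˡ , *-identityʳ
      ; distrib = distribˡ , distribʳ }
    ; *-comm = *-comm }

  ℤ[X] : CommutativeRing 0ℓ 0ℓ
  ℤ[X] = record { isCommutativeRing = isCommutativeRing }

  X : Fin V → Poly
  X v = var v ∷ []

record Enumeration (A : Set) : Set where
  constructor enumeration
  field
    elements : List A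
    complete : ∀ x → x ∈ elements
    unique : Unique elements
open Enumeration public

module _ {A : Set} (E : Enumeration A) where

  index : A → Fin (L.length (elements E))
  index x = Any.index (complete E x)

  lookup-index : ∀ x → L.lookup (elements E) (index x) ≡ x
  lookup-index x = sym (AnyP.lookup-index (complete E x))

  index-lookup : ∀ i → index (L.lookup (elements E) i) ≡ i
  index-lookup i = lookup-injective (unique E) _ _ (lookup-index (L.lookup (elements E) i))
    where
    lookup-injective : ∀ {xs : List A} → Unique xs → ∀ i j → L.lookup xs i ≡ L.lookup xs j → i ≡ j
    lookup-injective (_ ∷ _) zero zero _ = refl
    lookup-injective {x ∷ xs} (x∉xs ∷ _) zero (suc j) x≡ = ⊥-elim (All.lookup x∉xs (∈P.∈-lookup j) x≡)
    lookup-injective {x ∷ xs} (x∉xs ∷ _) (suc i) zero ≡x = ⊥-elim (All.lookup x∉xs (∈P.∈-lookup i) (sym ≡x))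
    lookup-injective (_ ∷ u) (suc i) (suc j) eq = cong suc (lookup-injective u i j eq)

-- Within a list, the r-th element with key κ is matched with the r-th element with key (flip κ).
module Pairing {U K : Set} (_≟_ : DecidableEquality K) (key : U → K) where

  private
    bit : Bool → ℕ
    bit true = 1
    bit false = 0

  count : K → List U → ℕ
  count κ [] = 0
  count κ (u ∷ us) = bit (does (key u ≟ κ)) ℕ.+ count κ us

  rank : (us : List U) → Fin (L.length us) → ℕ
  rank (u ∷ us) zero = 0
  rank (u ∷ us) (suc i) = bit (does (key u ≟ key (L.lookup us i))) ℕ.+ rank us i

  select : (κ : K) (us : List U) (r : ℕ) → r < count κ us → Fin (L.length us)
  select κ (u ∷ us) r r< with key u ≟ κ
  select κ (u ∷ us) zero r< | yes _ = zero
  select κ (u ∷ us) (suc r) r< | yes _ = suc (select κ us r (ℕP.≤-pred r<))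
  select κ (u ∷ us) r r< | no _ = suc (select κ us r r<)

  key-select : ∀ κ us r r< → key (L.lookup us (select κ us r r<)) ≡ κ
  key-select κ (u ∷ us) r r< with key u ≟ κ
  key-select κ (u ∷ us) zero r< | yes ku≡κ = ku≡κ
  key-select κ (u ∷ us) (suc r) r< | yes _ = key-select κ us r (ℕP.≤-pred r<)
  key-select κ (u ∷ us) r r< | no _ = key-select κ us r r<

  rank-select : ∀ κ us r r< → rank us (select κ us r r<) ≡ r
  rank-select κ (u ∷ us) r r< with key u ≟ κ
  rank-select κ (u ∷ us) zero r< | yes _ = refl
  rank-select κ (u ∷ us) (suc r) r< | yes ku≡κ with key u ≟ key (L.lookup us (select κ us r (ℕP.≤-pred r<)))
  ... | yes _ = cong suc (rank-select κ us r (ℕP.≤-pred r<))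
  ... | no ku≢ = ⊥-elim (ku≢ (trans ku≡κ (sym (key-select κ us r (ℕP.≤-pred r<)))))
  rank-select κ (u ∷ us) r r< | no ku≢κ with key u ≟ key (L.lookup us (select κ us r r<))
  ... | yes ku≡ = ⊥-elim (ku≢κ (trans ku≡ (key-select κ us r r<)))
  ... | no _ = rank-select κ us r r<

  rank<count : ∀ us i → rank us i < count (key (L.lookup us i)) us
  rank<count (u ∷ us) zero with key u ≟ key u
  ... | yes _ = s≤s z≤n
  ... | no ku≢ku = ⊥-elim (ku≢ku refl)
  rank<count (u ∷ us) (suc i) = ℕP.+-monoʳ-< (bit (does (key u ≟ key (L.lookup us i)))) (rank<count us i)

  select-rank : ∀ us i r< → select (key (L.lookup us i)) us (rank us i) r< ≡ i
  select-rank (u ∷ us) zero r< with key u ≟ key u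
  ... | yes _ = refl
  ... | no ku≢ku = ⊥-elim (ku≢ku refl)
  select-rank (u ∷ us) (suc i) r< with key u ≟ key (L.lookup us i)
  ... | yes _ = cong suc (select-rank us i (ℕP.≤-pred r<))
  ... | no _ = cong suc (select-rank us i r<)

  select-cong : ∀ {κ κ′ r r′} us r< r′< → κ ≡ κ′ → r ≡ r′ → select κ us r r< ≡ select κ′ us r′ r′<
  select-cong us r< r′< refl refl = cong (select _ us _) (ℕP.<-irrelevant r< r′<)

  module Partner (flip : K → K) (flip-involutive : ∀ κ → flip (flip κ) ≡ κ)
                 (us : List U) (balanced : ∀ κ → count κ us ≡ count (flip κ) us) where

    partner : Fin (L.length us) → Fin (L.length us)
    partner i = select (flip (key (L.lookup us i))) us (rank us i) (subst (rank us i <_) (balanced _) (rank<count us i))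

    key-partner : ∀ i → key (L.lookup us (partner i)) ≡ flip (key (L.lookup us i))
    key-partner i = key-select _ us _ _

    partner-involutive : ∀ i → partner (partner i) ≡ i
    partner-involutive i = trans
      (select-cong us _ (rank<count us i) (trans (cong flip (key-partner i)) (flip-involutive _)) (rank-select _ us _ _))
      (select-rank us i (rank<count us i))

enumerate-⊎ : ∀ {A B : Set} → Enumeration A → Enumeration B → Enumeration (A ⊎ B)
enumerate-⊎ EA EB = enumeration (L.map inj₁ (elements EA) ++ L.map inj₂ (elements EB)) complete′
  (UniqueP.++⁺ (UniqueP.map⁺ (λ { refl → refl }) (unique EA)) (UniqueP.map⁺ (λ { refl → refl }) (unique EB)) disjoint)
  where
  complete′ : ∀ x → x ∈ (L.map inj₁ (elements EA) ++ L.map inj₂ (elements EB))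
  complete′ (inj₁ a) = ∈P.∈-++⁺ˡ (∈P.∈-map⁺ inj₁ (complete EA a))
  complete′ (inj₂ b) = ∈P.∈-++⁺ʳ _ (∈P.∈-map⁺ inj₂ (complete EB b))
  disjoint : ∀ {v} → ¬ (v ∈ L.map inj₁ (elements EA) × v ∈ L.map inj₂ (elements EB))
  disjoint (v∈₁ , v∈₂) with ∈P.∈-map⁻ inj₁ v∈₁ | ∈P.∈-map⁻ inj₂ v∈₂
  ... | _ , _ , refl | _ , _ , ()

module _ {V : ℕ} where

  open Polynomials V

  generatingFunction : (S : SignedSet V) → Enumeration (Carrier S) → Poly
  generatingFunction S E = L.map (w S) (elements E)

  weight-≟ : DecidableEquality (Weight V)
  weight-≟ (s , a) (t , b) with a ≟ᵉ b | s BP.≟ t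
  ... | yes refl | yes refl = yes refl
  ... | no a≢b | _ = no (λ eq → a≢b (cong proj₂ eq))
  ... | yes _ | no s≢t = no (λ eq → s≢t (cong proj₁ eq))

  wneg-involutive : ∀ (κ : Weight V) → wneg (wneg κ) ≡ κ
  wneg-involutive (s , a) = cong (_, a) (BP.not-involutive s)

  sijection : (S T : SignedSet V) (ES : Enumeration (Carrier S)) (ET : Enumeration (Carrier T)) →
              generatingFunction S ES ≈ generatingFunction T ET → Sijection S T
  sijection S T ES ET gf≈ = record { f = f ; involutive = involutive ; weight-same = same ; weight-cross = cross }
    where
    EU = enumerate-⊎ ES ET
    us = elements EU
    -- an element of T counts with the opposite sign
    key : Carrier S ⊎ Carrier T → Weight V
    key (inj₁ s) = w S s
    key (inj₂ t) = wneg (w T t)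
    open Pairing weight-≟ key

    signedCount : ∀ e vs → sumℤ vs (λ u → termCoefficient e (key u)) +ℤ + count (true , e) vs ≡ + count (false , e) vs
    signedCount e [] = refl
    signedCount e (u ∷ vs) with key u | signedCount e vs
    ... | (s , a) | ih with a ≟ᵉ e
    ... | no _ = trans (cong (_+ℤ + count (true , e) vs) (ℤP.+-identityˡ (sumℤ vs (λ u → termCoefficient e (key u))))) ih
    signedCount e (u ∷ vs) | (true , a) | ih | yes refl = begin
      -[1+ 0 ] +ℤ t +ℤ (+ 1 +ℤ + n)   ≡⟨ ℤP.+-assoc -[1+ 0 ] t (+ 1 +ℤ + n) ⟩
      -[1+ 0 ] +ℤ (t +ℤ (+ 1 +ℤ + n)) ≡⟨ cong (-[1+ 0 ] +ℤ_) (x∙yz≈y∙xz t (+ 1) (+ n)) ⟩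
      -[1+ 0 ] +ℤ (+ 1 +ℤ (t +ℤ + n)) ≡⟨ ℤP.+-assoc -[1+ 0 ] (+ 1) (t +ℤ + n) ⟨
      + 0 +ℤ (t +ℤ + n)               ≡⟨ ℤP.+-identityˡ _ ⟩
      t +ℤ + n                        ≡⟨ ih ⟩
      _                               ∎
      where
      open ≡-Reasoning
      t = sumℤ vs (λ u → termCoefficient a (key u))
      n = count (true , a) vs
    signedCount e (u ∷ vs) | (false , a) | ih | yes refl =
      trans (ℤP.+-assoc (+ 1) (sumℤ vs (λ u → termCoefficient a (key u))) _) (cong (+ 1 +ℤ_) ih)

    keys-cancel : ∀ e → sumℤ us (λ u → termCoefficient e (key u)) ≡ + 0
    keys-cancel e = begin
      sumℤ us (λ u → termCoefficient e (key u))
        ≡⟨ sumℤ-++ (L.map inj₁ (elements ES)) (L.map inj₂ (elements ET)) c ⟩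
      sumℤ (L.map inj₁ (elements ES)) (λ u → termCoefficient e (key u)) +ℤ sumℤ (L.map inj₂ (elements ET)) (λ u → termCoefficient e (key u))
        ≡⟨ cong₂ _+ℤ_ (sumℤ-map (elements ES) inj₁ c) (sumℤ-map (elements ET) inj₂ c) ⟩
      sumℤ (elements ES) (λ s → termCoefficient e (w S s)) +ℤ sumℤ (elements ET) (λ t → termCoefficient e (wneg (w T t)))
        ≡⟨ cong₂ (λ x y → x +ℤ y) (sym (sumℤ-map (elements ES) (w S) (termCoefficient e)))
                 (trans (sumℤ-cong (elements ET) (λ t → termCoefficient-neg e (w T t))) (sumℤ-neg (elements ET) (termCoefficient e ∘ w T))) ⟩
      coefficient e (generatingFunction S ES) +ℤ -ℤ sumℤ (elements ET) (λ t → termCoefficient e (w T t))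
        ≡⟨ cong (λ y → coefficient e (generatingFunction S ES) +ℤ -ℤ y)
                (trans (sym (sumℤ-map (elements ET) (w T) (termCoefficient e))) (sym (coefficients gf≈ e))) ⟩
      coefficient e (generatingFunction S ES) +ℤ -ℤ coefficient e (generatingFunction S ES)
        ≡⟨ ℤP.+-inverseʳ (coefficient e (generatingFunction S ES)) ⟩
      + 0 ∎
      where
      open ≡-Reasoning
      c : Carrier S ⊎ Carrier T → ℤ
      c u = termCoefficient e (key u)

    balanced-at : ∀ e → count (true , e) us ≡ count (false , e) us
    balanced-at e = ℤP.+-injective (trans (sym (ℤP.+-identityˡ _))
      (trans (cong (_+ℤ + count (true , e) us) (sym (keys-cancel e))) (signedCount e us)))

    balanced : ∀ κ → count κ us ≡ count (wneg κ) us
    balanced (true , e) = balanced-at e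
    balanced (false , e) = sym (balanced-at e)

    open Partner wneg wneg-involutive us balanced

    f : Carrier S ⊎ Carrier T → Carrier S ⊎ Carrier T
    f u = L.lookup us (partner (index EU u))

    involutive : ∀ u → f (f u) ≡ u
    involutive u = trans (cong (λ i → L.lookup us (partner i)) (index-lookup EU (partner (index EU u))))
                         (trans (cong (L.lookup us) (partner-involutive (index EU u))) (lookup-index EU u))

    key-f : ∀ u → key (f u) ≡ wneg (key u)
    key-f u = trans (key-partner (index EU u)) (cong (λ v → wneg (key v)) (lookup-index EU u))

    wneg-injective : ∀ {a b : Weight V} → wneg a ≡ wneg b → a ≡ b
    wneg-injective {a} {b} eq = trans (sym (wneg-involutive a)) (trans (cong wneg eq) (wneg-involutive b))

    same : ∀ u → sameSide S T u (f u) ≡ true → wU S T (f u) ≡ wneg (wU S T u)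
    same u with f u | key-f u
    same (inj₁ s) | inj₁ s′ | eq = λ _ → eq
    same (inj₂ t) | inj₂ t′ | eq = λ _ → wneg-injective eq
    same (inj₁ s) | inj₂ t′ | eq = λ ()
    same (inj₂ t) | inj₁ s′ | eq = λ ()

    cross : ∀ u → sameSide S T u (f u) ≡ false → wU S T (f u) ≡ wU S T u
    cross u with f u | key-f u
    cross (inj₁ s) | inj₂ t′ | eq = λ _ → wneg-injective eq
    cross (inj₂ t) | inj₁ s′ | eq = λ _ → trans eq (wneg-involutive (w T t))
    cross (inj₁ s) | inj₁ s′ | eq = λ ()
    cross (inj₂ t) | inj₂ t′ | eq = λ ()

concatMap-concatMap : ∀ {A B C : Set} (f : B → List C) (g : A → List B) xs →
                      concatMap f (concatMap g xs) ≡ concatMap (concatMap f ∘ g) xs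
concatMap-concatMap f g [] = refl
concatMap-concatMap f g (x ∷ xs) =
  trans (LP.concatMap-++ f (g x) _) (cong (concatMap f (g x) ++_) (concatMap-concatMap f g xs))

unique-concatMap : ∀ {A B : Set} (xs : List A) (g : A → List B) → Unique xs → (∀ x → Unique (g x)) →
                   (∀ {x y b} → b ∈ g x → b ∈ g y → x ≡ y) → Unique (concatMap g xs)
unique-concatMap [] g _ _ _ = []
unique-concatMap (x ∷ xs) g (x∉xs ∷ u) unique-g disjoint =
  UniqueP.++⁺ (unique-g x) (unique-concatMap xs g u unique-g disjoint) apart
  where
  apart : ∀ {b} → ¬ (b ∈ g x × b ∈ concatMap g xs)
  apart (b∈gx , b∈rest) = elsewhere (∈P.∈-concatMap⁻ g b∈rest) x∉xs
    where
    elsewhere : ∀ {ys} → Any.Any (λ y → _ ∈ g y) ys → All.All (x ≢_) ys → ⊥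
    elsewhere (here b∈gy) (x≢y ∷ _) = x≢y (disjoint b∈gx b∈gy)
    elsewhere (there b∈) (_ ∷ x≢ys) = elsewhere b∈ x≢ys

enumerate-Σ : ∀ {A : Set} {B : A → Set} → Enumeration A → (∀ a → Enumeration (B a)) → Enumeration (Σ A B)
enumerate-Σ {A} {B} EA EB = enumeration (concatMap fibre (elements EA)) complete′
  (unique-concatMap (elements EA) fibre (unique EA) (λ a → UniqueP.map⁺ (λ { refl → refl }) (unique (EB a))) disjoint)
  where
  fibre : (a : A) → List (Σ A B)
  fibre a = L.map (a ,_) (elements (EB a))
  complete′ : ∀ p → p ∈ concatMap fibre (elements EA)
  complete′ (a , b) = ∈P.∈-concatMap⁺ fibre (Any.map (λ { refl → ∈P.∈-map⁺ (a ,_) (complete (EB a) b) }) (complete EA a))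
  disjoint : ∀ {x y p} → p ∈ fibre x → p ∈ fibre y → x ≡ y
  disjoint p∈x p∈y with ∈P.∈-map⁻ _ p∈x | ∈P.∈-map⁻ _ p∈y
  ... | _ , _ , refl | _ , _ , refl = refl

enumerate-⊤ : Enumeration ⊤
enumerate-⊤ = enumeration (tt ∷ []) (λ { tt → here refl }) ([] ∷ [])

enumerate-Bool : Enumeration Bool
enumerate-Bool = enumeration (true ∷ false ∷ []) (λ { true → here refl ; false → there (here refl) }) (((λ ()) ∷ []) ∷ [] ∷ [])

enumerate-T : ∀ b → Enumeration (T b)
enumerate-T true = enumerate-⊤
enumerate-T false = enumeration [] (λ ()) []

allVecs : ∀ N L → List (Vec (Fin N) L)
allVecs N zero = [] ∷ []
allVecs N (suc L) = concatMap (λ a → L.map (a ∷_) (allVecs N L)) (allFin N)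

enumerate-Vec : ∀ N L → Enumeration (Vec (Fin N) L)
enumerate-Vec N L = enumeration (allVecs N L) (complete′ L) (unique′ L)
  where
  complete′ : ∀ L (v : Vec (Fin N) L) → v ∈ allVecs N L
  complete′ zero [] = here refl
  complete′ (suc L) (a ∷ v) =
    ∈P.∈-concatMap⁺ _ (Any.map (λ { refl → ∈P.∈-map⁺ (a ∷_) (complete′ L v) }) (∈P.∈-allFin a))
  unique′ : ∀ L → Unique (allVecs N L)
  unique′ zero = [] ∷ []
  unique′ (suc L) = unique-concatMap (allFin N) _ (UniqueP.allFin⁺ N) (λ a → UniqueP.map⁺ (λ { refl → refl }) (unique′ L)) disjoint
    where
    disjoint : ∀ {a b v} → v ∈ L.map (a ∷_) (allVecs N L) → v ∈ L.map (b ∷_) (allVecs N L) → a ≡ b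
    disjoint v∈a v∈b with ∈P.∈-map⁻ _ v∈a | ∈P.∈-map⁻ _ v∈b
    ... | _ , _ , refl | _ , _ , refl = refl

Composition : ℕ → ℕ → Set
Composition r n = Σ (Vec ℕ r) (λ a → V.sum a ≡ n)

prepend0 : ∀ {r n} → Composition r n → Composition (suc r) n
prepend0 (c , p) = 0 ∷ c , p

increment : ∀ {r n} → Composition (suc r) n → Composition (suc r) (suc n)
increment (x ∷ c , p) = suc x ∷ c , cong suc p

-- the recursion of the complete homogeneous polynomials
compositions : ∀ r n → List (Composition r n)
compositions zero zero = ([] , refl) ∷ []
compositions zero (suc n) = []
compositions (suc r) zero = L.map prepend0 (compositions r zero)
compositions (suc r) (suc n) = L.map prepend0 (compositions r (suc n)) ++ L.map increment (compositions (suc r) n)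

composition-≡ : ∀ {r n} {c c′ : Vec ℕ r} {p : V.sum c ≡ n} {p′ : V.sum c′ ≡ n} → c ≡ c′ → (c , p) ≡ (c′ , p′)
composition-≡ {p = p} {p′} refl = cong (_ ,_) (ℕP.≡-irrelevant p p′)

compositions-complete : ∀ r n (c : Vec ℕ r) (p : V.sum c ≡ n) → (c , p) ∈ compositions r n
compositions-complete zero zero [] refl = here refl
compositions-complete (suc r) zero (zero ∷ c) p = ∈P.∈-map⁺ prepend0 (compositions-complete r zero c p)
compositions-complete (suc r) (suc n) (zero ∷ c) p = ∈P.∈-++⁺ˡ (∈P.∈-map⁺ prepend0 (compositions-complete r (suc n) c p))
compositions-complete (suc r) (suc n) (suc x ∷ c) p = ∈P.∈-++⁺ʳ _
  (subst (λ q → (suc x ∷ c , q) ∈ L.map increment (compositions (suc r) n)) (ℕP.≡-irrelevant _ p)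
         (∈P.∈-map⁺ increment (compositions-complete (suc r) n (x ∷ c) (ℕP.suc-injective p))))

compositions-unique : ∀ r n → Unique (compositions r n)
compositions-unique zero zero = [] ∷ []
compositions-unique zero (suc n) = []
compositions-unique (suc r) zero = UniqueP.map⁺ prepend0-injective (compositions-unique r zero)
  where
  prepend0-injective : ∀ {x y : Composition r zero} → prepend0 x ≡ prepend0 y → x ≡ y
  prepend0-injective eq = composition-≡ (proj₂ (VP.∷-injective (cong proj₁ eq)))
compositions-unique (suc r) (suc n) = UniqueP.++⁺
  (UniqueP.map⁺ prepend0-injective (compositions-unique r (suc n)))
  (UniqueP.map⁺ (λ {x} {y} → increment-injective x y) (compositions-unique (suc r) n)) disjoint
  where
  prepend0-injective : ∀ {x y : Composition r (suc n)} → prepend0 x ≡ prepend0 y → x ≡ y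
  prepend0-injective eq = composition-≡ (proj₂ (VP.∷-injective (cong proj₁ eq)))
  increment-injective : ∀ (x y : Composition (suc r) n) → increment x ≡ increment y → x ≡ y
  increment-injective (a ∷ c , p) (b ∷ d , q) eq with VP.∷-injective (cong proj₁ eq)
  ... | refl , refl = composition-≡ refl
  disjoint : ∀ {v} → ¬ (v ∈ L.map prepend0 (compositions r (suc n)) × v ∈ L.map increment (compositions (suc r) n))
  disjoint (v∈₁ , v∈₂) with ∈P.∈-map⁻ prepend0 v∈₁ | ∈P.∈-map⁻ increment v∈₂
  ... | (c , _) , _ , refl | (b ∷ d , _) , _ , ()

enumerate-B : ∀ {V r} (zs : Vec (Fin V) r) (d : ℤ) → Enumeration (Carrier (B zs d))
enumerate-B {r = r} zs (+ n) = enumeration (L.map toB (compositions r n)) complete′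
  (UniqueP.map⁺ (λ {x} {y} → toB-injective x y) (compositions-unique r n))
  where
  toB : Composition r n → Carrier (B zs (+ n))
  toB (c , p) = c , cong +_ p
  complete′ : ∀ x → x ∈ L.map toB (compositions r n)
  complete′ (c , refl) = ∈P.∈-map⁺ toB (compositions-complete r (V.sum c) c refl)
  toB-injective : ∀ x y → toB x ≡ toB y → x ≡ y
  toB-injective (c , p) (d , q) eq = composition-≡ (cong proj₁ eq)
enumerate-B zs -[1+ n ] = enumeration [] (λ { (c , ()) }) []

enumerate-Tuple : ∀ {V} N (A : Fin N → SignedSet V) → (∀ i → Enumeration (Carrier (A i))) → Enumeration (Tuple N A)
enumerate-Tuple zero A E = enumerate-⊤
enumerate-Tuple (suc N) A E = enumerate-Σ (E zero) (λ _ → enumerate-Tuple N (A ∘ suc) (E ∘ suc))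

enumerate-D : ∀ {V N} (M : Fin N → Fin N → SignedSet V) → (∀ i j → Enumeration (Carrier (M i j))) → Enumeration (Carrier (D M))
enumerate-D {N = N} M E = enumerate-Σ (enumerate-Σ (enumerate-Vec N N) (λ v → enumerate-T (isPerm v)))
  (λ σ → enumerate-Tuple N (λ i → M i (lookup (proj₁ σ) i)) (λ i → E i (lookup (proj₁ σ) i)))

enumerate-^S : ∀ {V} (A : SignedSet V) → Enumeration (Carrier A) → ∀ m → Enumeration (Carrier (A ^S m))
enumerate-^S A EA zero = enumerate-⊤
enumerate-^S A EA (suc m) = enumerate-Σ EA (λ _ → enumerate-^S A EA m)

enumerate-prodS : ∀ {V} {I : Set} (F : I → SignedSet V) → (∀ i → Enumeration (Carrier (F i))) →
                  ∀ is → Enumeration (Carrier (prodS (L.map F is)))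
enumerate-prodS F EF [] = enumerate-⊤
enumerate-prodS F EF (i ∷ is) = enumerate-Σ (EF i) (λ _ → enumerate-prodS F EF is)

module GeneratingFunctions (V : ℕ) where

  open Polynomials V
  open CommutativeRing ℤ[X] using (_-_)
  open import Algebra.Properties.Semiring.Exp (CommutativeRing.semiring ℤ[X]) using (_^_)
  open import Algebra.Properties.Semiring.Sum (CommutativeRing.semiring ℤ[X]) using (sum-cong-≋) renaming (sum to ∑)
  open Determinant ℤ[X]
  open CompleteHomogeneous ℤ[X]
  open ConfluentVandermonde ℤ[X]

  ≈-reflexive : ∀ {p q} → p ≡ q → p ≈ q
  ≈-reflexive refl = ≈-refl

  generatingFunction-Σ : ∀ {A : Set} {B : A → Set} (EA : Enumeration A) (EB : ∀ a → Enumeration (B a)) (f : Σ A B → Weight V) →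
    L.map f (elements (enumerate-Σ EA EB)) ≡ concatMap (λ a → L.map (λ b → f (a , b)) (elements (EB a))) (elements EA)
  generatingFunction-Σ EA EB f =
    trans (LP.map-concatMap f _ (elements EA)) (LP.concatMap-cong (λ a → sym (LP.map-∘ (elements (EB a)))) (elements EA))

  concatMap-enumerate-Σ : ∀ {A : Set} {B : A → Set} {C : Set} (EA : Enumeration A) (EB : ∀ a → Enumeration (B a))
                          (f : Σ A B → List C) →
    concatMap f (elements (enumerate-Σ EA EB)) ≡ concatMap (λ a → concatMap (λ b → f (a , b)) (elements (EB a))) (elements EA)
  concatMap-enumerate-Σ EA EB f = trans (concatMap-concatMap f (λ a → L.map (a ,_) (elements (EB a))) (elements EA))
    (LP.concatMap-cong (λ a → LP.concatMap-map f (a ,_) (elements (EB a))) (elements EA))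

  concatMap-w* : ∀ {A B : Set} (xs : List A) (ys : List B) (f : A → Weight V) (g : B → Weight V) →
                 concatMap (λ a → L.map (λ b → f a w* g b) ys) xs ≡ L.map f xs *ᴾ L.map g ys
  concatMap-w* [] ys f g = refl
  concatMap-w* (x ∷ xs) ys f g = cong₂ _++_ (LP.map-∘ ys) (concatMap-w* xs ys f g)

  generatingFunction-⊗ : (A B : SignedSet V) (EA : Enumeration (Carrier A)) (EB : Enumeration (Carrier B)) →
    generatingFunction (A ⊗ B) (enumerate-Σ EA (λ _ → EB)) ≡ generatingFunction A EA *ᴾ generatingFunction B EB
  generatingFunction-⊗ A B EA EB =
    trans (generatingFunction-Σ EA (λ _ → EB) (w (A ⊗ B))) (concatMap-w* (elements EA) (elements EB) (w A) (w B))

  generatingFunction-^S : ∀ (A : SignedSet V) (EA : Enumeration (Carrier A)) m →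
    generatingFunction (A ^S m) (enumerate-^S A EA m) ≈ generatingFunction A EA ^ m
  generatingFunction-^S A EA zero = ≈-refl
  generatingFunction-^S A EA (suc m) = ≈-trans (≈-reflexive (generatingFunction-⊗ A (A ^S m) EA (enumerate-^S A EA m)))
                                               (*-congˡ {generatingFunction A EA} (generatingFunction-^S A EA m))

  generatingFunction-prodS : ∀ {I : Set} (F : I → SignedSet V) (EF : ∀ i → Enumeration (Carrier (F i))) is →
    generatingFunction (prodS (L.map F is)) (enumerate-prodS F EF is) ≈ listProduct (L.map (λ i → generatingFunction (F i) (EF i)) is)
  generatingFunction-prodS F EF [] = ≈-refl
  generatingFunction-prodS F EF (i ∷ is) =
    ≈-trans (≈-reflexive (generatingFunction-⊗ (F i) (prodS (L.map F is)) (EF i) (enumerate-prodS F EF is)))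
            (*-congˡ {generatingFunction (F i) (EF i)} (generatingFunction-prodS F EF is))

  generatingFunction-Tuple : ∀ {L N} (M : Fin L → Fin N → SignedSet V) (E : ∀ i j → Enumeration (Carrier (M i j))) v →
    L.map (tupleW L (λ i → M i (lookup v i))) (elements (enumerate-Tuple L (λ i → M i (lookup v i)) (λ i → E i (lookup v i))))
      ≈ rowProduct (λ i j → generatingFunction (M i j) (E i j)) v
  generatingFunction-Tuple M E [] = ≈-refl
  generatingFunction-Tuple {suc L} M E (a ∷ v) = ≈-trans
    (≈-reflexive (trans (generatingFunction-Σ (E zero a) (λ _ → rest) (tupleW (suc L) (λ i → M i (lookup (a ∷ v) i))))
                        (concatMap-w* (elements (E zero a)) (elements rest) (w (M zero a)) (tupleW L (λ i → M (suc i) (lookup v i))))))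
    (*-congˡ {generatingFunction (M zero a) (E zero a)} (generatingFunction-Tuple (M ∘ suc) (E ∘ suc) v))
    where
    rest = enumerate-Tuple L (λ i → M (suc i) (lookup v i)) (λ i → E (suc i) (lookup v i))

  concatMap-cong≈ : ∀ {A : Set} (xs : List A) {f g : A → Poly} → (∀ x → f x ≈ g x) → concatMap f xs ≈ concatMap g xs
  concatMap-cong≈ [] f≈g = ≈-refl
  concatMap-cong≈ (x ∷ xs) f≈g = +-cong (f≈g x) (concatMap-cong≈ xs f≈g)

  concatMap-allFin : ∀ {N} (f : Fin N → Poly) → concatMap f (allFin N) ≡ ∑ f
  concatMap-allFin {N} f = trans (cong L.concat (LP.map-tabulate (λ i → i) f)) (tabulated f)
    where
    tabulated : ∀ {m} (g : Fin m → Poly) → L.concat (L.tabulate g) ≡ ∑ g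
    tabulated {zero} g = refl
    tabulated {suc m} g = cong (g zero ++_) (tabulated (g ∘ suc))

  concatMap-allVecs : ∀ {N} L (F : Vec (Fin N) L → Poly) → concatMap F (allVecs N L) ≈ ∑ᵛ L F
  concatMap-allVecs zero F = +-identityʳ (F [])
  concatMap-allVecs {N} (suc L) F = ≈-trans
    (≈-reflexive (trans (concatMap-concatMap F (λ a → L.map (a ∷_) (allVecs N L)) (allFin N))
                 (trans (LP.concatMap-cong (λ a → LP.concatMap-map F (a ∷_) (allVecs N L)) (allFin N))
                        (concatMap-allFin (λ a → concatMap (λ v → F (a ∷ v)) (allVecs N L))))))
    (sum-cong-≋ {N} (λ a → concatMap-allVecs L (λ v → F (a ∷ v))))

  generatingFunction-D : ∀ {N} (M : Fin N → Fin N → SignedSet V) (E : ∀ i j → Enumeration (Carrier (M i j))) →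
    generatingFunction (D M) (enumerate-D M E) ≈ det (λ i j → generatingFunction (M i j) (E i j))
  generatingFunction-D {N} M E = begin
    generatingFunction (D M) (enumerate-D M E)
      ≡⟨ generatingFunction-Σ perms tuples (w (D M)) ⟩
    concatMap (λ σ → L.map (λ t → w (D M) (σ , t)) (elements (tuples σ))) (elements perms)
      ≡⟨ concatMap-enumerate-Σ (enumerate-Vec N N) (λ v → enumerate-T (isPerm v))
                               (λ σ → L.map (λ t → w (D M) (σ , t)) (elements (tuples σ))) ⟩
    concatMap (λ v → concatMap (λ _ → term v) (isPermutation v)) (allVecs N N)
      ≈⟨ concatMap-cong≈ (allVecs N N) (λ v → concatMap-cong≈ (isPermutation v) (λ _ → term≈ v)) ⟩
    concatMap (λ v → concatMap (λ _ → (unsigned v ∷ []) *ᴾ rowProduct gf v) (isPermutation v)) (allVecs N N)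
      ≈⟨ concatMap-cong≈ (allVecs N N) (λ v → selected (isPerm v) (sgnNeg v) (rowProduct gf v)) ⟩
    concatMap (λ v → sign v *ᴾ rowProduct gf v) (allVecs N N)
      ≈⟨ concatMap-allVecs N (λ v → sign v *ᴾ rowProduct gf v) ⟩
    det gf  ∎
    where
    open import Relation.Binary.Reasoning.Setoid (CommutativeRing.setoid ℤ[X])
    perms = enumerate-Σ (enumerate-Vec N N) (λ v → enumerate-T (isPerm v))
    isPermutation : (v : Vec (Fin N) N) → List (T (isPerm v))
    isPermutation v = elements (enumerate-T (isPerm v))
    tuplesOf : (v : Vec (Fin N) N) → Enumeration (Tuple N (λ i → M i (lookup v i)))
    tuplesOf v = enumerate-Tuple N (λ i → M i (lookup v i)) (λ i → E i (lookup v i))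
    tuples : (σ : Perm N) → Enumeration (Tuple N (λ i → M i (lookup (proj₁ σ) i)))
    tuples σ = tuplesOf (proj₁ σ)
    unsigned : Vec (Fin N) N → Weight V
    unsigned v = sgnNeg v , V.replicate V 0
    term : Vec (Fin N) N → Poly
    term v = L.map (λ t → unsigned v w* tupleW N (λ i → M i (lookup v i)) t) (elements (tuplesOf v))
    gf : Matrix N N
    gf i j = generatingFunction (M i j) (E i j)
    term≈ : ∀ v → term v ≈ (unsigned v ∷ []) *ᴾ rowProduct gf v
    term≈ v = ≈-trans (≈-reflexive (LP.map-∘ (elements (tuplesOf v))))
      (≈-trans (≈-sym (monomial-* (unsigned v) _)) (*-congˡ {unsigned v ∷ []} (generatingFunction-Tuple M E v)))
    -- the weight (sgnNeg v , 0) is the monomial of sign v, when v is a permutation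
    selected : ∀ b s R → concatMap (λ _ → ((s , V.replicate V 0) ∷ []) *ᴾ R) (elements (enumerate-T b)) ≈ signOf b s *ᴾ R
    selected false s R = ≈-refl
    selected true true R = +-identityʳ (((true , V.replicate V 0) ∷ []) *ᴾ R)
    selected true false R = +-identityʳ (((false , V.replicate V 0) ∷ []) *ᴾ R)

  private
    weight-prepend0 : ∀ {r} z (zs : Vec (Fin V) r) m →
      L.map (monoW (z ∷ zs) ∘ proj₁) (L.map prepend0 (compositions r m)) ≡ L.map (monoW zs ∘ proj₁) (compositions r m)
    weight-prepend0 {r} z zs m =
      trans (sym (LP.map-∘ (compositions r m))) (LP.map-cong (λ c → wone-w* (monoW zs (proj₁ c))) (compositions r m))

    weight-increment : ∀ {r} z (zs : Vec (Fin V) r) m →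
      L.map (monoW (z ∷ zs) ∘ proj₁) (L.map increment (compositions (suc r) m))
        ≡ L.map (var z w*_) (L.map (monoW (z ∷ zs) ∘ proj₁) (compositions (suc r) m))
    weight-increment {r} z zs m =
      trans (sym (LP.map-∘ (compositions (suc r) m)))
            (trans (LP.map-cong times-z (compositions (suc r) m)) (LP.map-∘ (compositions (suc r) m)))
      where
      times-z : ∀ (c : Composition (suc r) m) → monoW (z ∷ zs) (proj₁ (increment c)) ≡ var z w* monoW (z ∷ zs) (proj₁ c)
      times-z (x ∷ c , _) = w*-assoc (var z) (wpow (var z) x) (monoW zs c)

  generatingFunction-compositions : ∀ {r} (zs : Vec (Fin V) r) n →
    L.map (monoW zs ∘ proj₁) (compositions r n) ≈ h (L.map X (V.toList zs)) n
  generatingFunction-compositions [] zero = ≈-refl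
  generatingFunction-compositions [] (suc n) = ≈-refl
  generatingFunction-compositions (z ∷ zs) zero =
    ≈-trans (≈-reflexive (weight-prepend0 z zs zero)) (generatingFunction-compositions zs zero)
  generatingFunction-compositions {suc r} (z ∷ zs) (suc n) = ≈-trans
    (≈-reflexive (LP.map-++ (monoW (z ∷ zs) ∘ proj₁) (L.map prepend0 (compositions r (suc n)))
                            (L.map increment (compositions (suc r) n))))
    (+-cong (≈-trans (≈-reflexive (weight-prepend0 z zs (suc n))) (generatingFunction-compositions zs (suc n)))
            (≈-trans (≈-reflexive (weight-increment z zs n))
                     (≈-trans (≈-sym (monomial-* (var z) _)) (*-congˡ {X z} (generatingFunction-compositions (z ∷ zs) n)))))

  generatingFunction-B : ∀ {r} (zs : Vec (Fin V) r) d → generatingFunction (B zs d) (enumerate-B zs d) ≈ hℤ (L.map X (V.toList zs)) d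
  generatingFunction-B {r} zs (+ n) = ≈-trans (≈-reflexive (sym (LP.map-∘ (compositions r n)))) (generatingFunction-compositions zs n)
  generatingFunction-B zs -[1+ n ] = ≈-refl

enumerate-H : ∀ k n (α : Vec ℕ n) r c → Enumeration (Carrier (H k n α r c))
enumerate-H k n α r c with rowInfo α r
... | l , i = enumerate-B (ys k n V.++ V.replicate (suc (toℕ i)) (xv k l)) (+ toℕ c ℤ.- + toℕ i)

pairPower : ∀ k {n} (α : Vec ℕ n) → Fin n × Fin n → SignedSet (k ℕ.+ n)
pairPower k α (i , j) = pair (var (xv k j)) (wneg (var (xv k i))) ^S (lookup α i ℕ.* lookup α j)

enumerate-pairPower : ∀ k {n} (α : Vec ℕ n) p → Enumeration (Carrier (pairPower k α p))
enumerate-pairPower k α (i , j) = enumerate-^S _ enumerate-Bool (lookup α i ℕ.* lookup α j)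

enumerate-RHS : ∀ k n (α : Vec ℕ n) → Enumeration (Carrier (RHS k n α))
enumerate-RHS k n α = enumerate-prodS (pairPower k α) (enumerate-pairPower k α) (pairsLT n)

module Instantiation (k n : ℕ) where

  open Polynomials (k ℕ.+ n)
  open GeneratingFunctions (k ℕ.+ n)
  open Determinant ℤ[X]
  open CompleteHomogeneous ℤ[X]
  open ConfluentVandermonde ℤ[X]

  Y : List Poly
  Y = L.map X (V.toList (ys k n))

  generatingFunction-H : ∀ (α : Vec ℕ n) r c →
                         generatingFunction (H k n α r c) (enumerate-H k n α r c) ≈ confluent Y (X ∘ xv k) α r c
  generatingFunction-H α r c with rowInfo α r
  ... | l , i = ≈-trans (generatingFunction-B zs (+ toℕ c ℤ.- + toℕ i))
                        (≈-reflexive (cong (λ ws → hℤ ws (+ toℕ c ℤ.- + toℕ i)) variables))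
    where
    zs = ys k n V.++ V.replicate (suc (toℕ i)) (xv k l)
    variables : L.map X (V.toList zs) ≡ Y ++ L.replicate (suc (toℕ i)) (X (xv k l))
    variables = trans (cong (L.map X) (VP.toList-++ (ys k n) _))
      (trans (LP.map-++ X (V.toList (ys k n)) _)
             (cong (Y ++_) (trans (cong (L.map X) (VP.toList-replicate (suc (toℕ i)) _)) (LP.map-replicate X _ _))))

  generatingFunction-RHS : ∀ (α : Vec ℕ n) →
    generatingFunction (RHS k n α) (enumerate-RHS k n α) ≈ listProduct (L.map (pairFactor (X ∘ xv k) α) (pairsLT n))
  generatingFunction-RHS α = ≈-trans (generatingFunction-prodS (pairPower k α) (enumerate-pairPower k α) (pairsLT n))
                                     (listProduct-cong (pairsLT n))
    where
    listProduct-cong : ∀ ps → listProduct (L.map (λ p → generatingFunction (pairPower k α p) (enumerate-pairPower k α p)) ps)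
                            ≈ listProduct (L.map (pairFactor (X ∘ xv k) α) ps)
    listProduct-cong [] = ≈-refl
    listProduct-cong ((i , j) ∷ ps) = *-cong (generatingFunction-^S _ enumerate-Bool (lookup α i ℕ.* lookup α j)) (listProduct-cong ps)

  generatingFunctions-agree : ∀ (α : Vec ℕ n) →
    generatingFunction (D (H k n α)) (enumerate-D (H k n α) (enumerate-H k n α)) ≈ generatingFunction (RHS k n α) (enumerate-RHS k n α)
  generatingFunctions-agree α = begin
    generatingFunction (D (H k n α)) (enumerate-D (H k n α) (enumerate-H k n α))  ≈⟨ generatingFunction-D (H k n α) (enumerate-H k n α) ⟩
    det (λ r c → generatingFunction (H k n α r c) (enumerate-H k n α r c))       ≈⟨ det-cong (generatingFunction-H α) ⟩
    det (confluent Y (X ∘ xv k) α)                                                ≈⟨ det-confluent Y (X ∘ xv k) α ⟩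
    differenceProduct (X ∘ xv k) α                                                ≈⟨ differenceProduct-pairsLT (X ∘ xv k) α ⟨
    listProduct (L.map (pairFactor (X ∘ xv k) α) (pairsLT n))                     ≈⟨ generatingFunction-RHS α ⟨
    generatingFunction (RHS k n α) (enumerate-RHS k n α)                          ∎
    where open import Relation.Binary.Reasoning.Setoid (CommutativeRing.setoid ℤ[X])

theorem2p27 : (k n : ℕ) (α : Vec ℕ n) → Sijection (D (H k n α)) (RHS k n α)
theorem2p27 k n α = sijection _ _ (enumerate-D (H k n α) (enumerate-H k n α)) (enumerate-RHS k n α)
                                  (Instantiation.generatingFunctions-agree k n α)
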